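{- Let $m,n$ be positive integers, $C=(c_1,\dots,c_n)\in\mathrm{Mat}_{m\times n}(\mathbb{Z})$ with every column $c_j=(c_{1j},\dots,c_{mj})^T\neq0$, and $b\in\mathbb{Z}^n$. With $H_{J,q}$, $L_q$, $\rho_0$ and $q^*$ as defined in the context, suppose $q,q'\in\mathbb{Z}_{>0}$ satisfy $q,q'>q^*$ and $\gcd\{\rho_0,q\}=\gcd\{\rho_0,q'\}$. Then $L_q$ is isomorphic to $L_{q'}$. In particular, $L_q\simeq L_{q+\rho_0}$ for all $q>q^*$, i.e. the sequence of isomorphism classes of $L_q$, $q=1,2,\dots$, is periodic in $q>q^*$ with period $\rho_0$.
   Context: $[n]=\{1,\dots,n\}$, $\mathbb{Z}_q=\mathbb{Z}/q\mathbb{Z}$, $[\cdot]_q$ is entrywise reduction mod $q$. For $J\subseteq[n]$, $H_{J,q}=\{z\in\mathbb{Z}_q^m: z[c_j]_q=[b_j]_q\ \forall j\in J\}$ ($H_{\emptyset,q}=\mathbb{Z}_q^m$). The intersection poset is $L_q=\{H_{J,q}\neq\emptyset: J\subseteq[n]\}$ ordered by reverse inclusion, with elements indexed by the sets $J$. $L_q$ and $L_{q'}$ are called isomorphic iff (1) for all $J\subseteq[n]$: $H_{J,q}\in L_q \iff H_{J,q'}\in L_{q'}$ (i.e. nonempty), and (2) for all $J_1,J_2\subseteq[n]$ with $H_{J_1,q},H_{J_2,q}\in L_q$ and $H_{J_1,q'},H_{J_2,q'}\in L_{q'}$: $H_{J_1,q}\le H_{J_2,q}\iff H_{J_1,q'}\le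 H_{J_2,q'}$. For nonempty $J=\{j_1<\cdots<j_k\}$ let $C_J=(c_{j_1},\dots,c_{j_k})$, $b_J=(b_{j_1},\dots,b_{j_k})$, $A_J=\binom{C_J}{b_J}$, and let $e(J)$, $e'(J)$ be the largest elementary divisors (last Smith normal form invariant factors) over $\mathbb{Z}$ of $C_J$, $A_J$. Then $\rho_0=\mathrm{lcm}\{e(J):\emptyset\ne J\subseteq[n]\}$, $q_0=\max\{e'(J):J\ne\emptyset,\ \mathrm{rank}\,A_J=\mathrm{rank}\,C_J+1\}$, $q_1=\max\{e(J\cup\{j\}): j\in[n],\ J\ne\emptyset,\ \mathrm{rank}\,C_{J\cup\{j\}}=\mathrm{rank}\,C_J+1\}$ (maxima over empty sets are $0$), and $q^*=\max\{q_0,q_1,\max_j\gcd\{c_{1j},\dots,c_{mj}\}\}$ with positive gcds. -}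

module Defs where

open import Data.Nat as ℕ using (ℕ; zero; suc; _<_; _≤_; _⊔_; _≡ᵇ_; _<ᵇ_)
open import Data.Nat.GCD using (gcd)
open import Data.Nat.LCM using (lcm)
open import Data.Nat.Divisibility as ℕD using ()
open import Data.Integer as ℤ using (ℤ; +_; _-_; ∣_∣)
open import Data.Integer.Divisibility as ℤD using ()
open import Data.Fin as Fin using (Fin; toℕ; splitAt)
open import Data.Fin.Subset using (Subset; inside; outside; _∈_; _∪_; ⁅_⁆; Nonempty)
open import Data.Fin.Subset.Properties using (nonempty?)
open import Data.Vec as Vec using (Vec; []; _∷_)
open import Data.List as List using (List; []; _∷_; length; lookup; allFin; filter; map; foldr; concatMap; _++_)
open import Data.Bool using (Bool; true; false; if_then_else_; _∧_)
open import Data.Sum using ([_,_])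
open import Data.Product using (Σ; ∃; _×_; _,_)
open import Relation.Nullary using (¬_; Dec; yes; no)
open import Relation.Nullary.Decidable using (⌊_⌋)
open import Relation.Binary.PropositionalEquality using (_≡_)

Mat : ℕ → ℕ → Set
Mat p k = Fin p → Fin k → ℤ

Σℤ : ∀ {k} → (Fin k → ℤ) → ℤ
Σℤ {zero}  f = + 0
Σℤ {suc k} f = f Fin.zero ℤ.+ Σℤ (λ i → f (Fin.suc i))

_⊗_ : ∀ {p k l} → Mat p k → Mat k l → Mat p l
(A ⊗ B) i j = Σℤ (λ t → A i t ℤ.* B t j)

idMat : ∀ {p} → Mat p p
idMat i j = if toℕ i ≡ᵇ toℕ j then + 1 else + 0

diagMat : ∀ {p k} → ℕ → (ℕ → ℕ) → Mat p k
diagMat r d i j = if (toℕ i ≡ᵇ toℕ j) ∧ (toℕ i <ᵇ r) then + d (toℕ i) else + 0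

-- largest invariant factor, given the number r of nonzero invariant
-- factors d 0 ∣ d 1 ∣ ... ∣ d (r-1)   (0 by convention if r = 0)
lastFactor : ℕ → (ℕ → ℕ) → ℕ
lastFactor zero    d = 0
lastFactor (suc r) d = d r

-- Smith normal form over ℤ: U A V = diag(d_0,...,d_{r-1},0,...,0) with
-- U, V unimodular, d_i > 0, d_i ∣ d_{i+1}.  "SNF A r e" says that A has a
-- Smith normal form with exactly r nonzero invariant factors (so rank A = r)
-- and largest elementary divisor (last invariant factor) e.
record SNF {p k : ℕ} (A : Mat p k) (r e : ℕ) : Set where
  field
    U U' : Mat p p
    V V' : Mat k k
    UU'  : ∀ i j → (U ⊗ U') i j ≡ idMat i j
    U'U  : ∀ i j → (U' ⊗ U) i j ≡ idMat i j
    VV'  : ∀ i j → (V ⊗ V') i j ≡ idMat i j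
    V'V  : ∀ i j → (V' ⊗ V) i j ≡ idMat i j
    d    : ℕ → ℕ
    r≤p  : r ≤ p
    r≤k  : r ≤ k
    dpos : ∀ i → i < r → 0 < d i
    ddiv : ∀ i → suc i < r → d i ℕD.∣ d (suc i)
    diag : ∀ i j → ((U ⊗ A) ⊗ V) i j ≡ diagMat r d i j
    last : e ≡ lastFactor r d

elems : ∀ {n} → Subset n → List (Fin n)
elems []             = []
elems (inside  ∷ p)  = Fin.zero ∷ map Fin.suc (elems p)
elems (outside ∷ p)  = map Fin.suc (elems p)

allSubsets : ∀ n → List (Subset n)
allSubsets zero    = [] ∷ []
allSubsets (suc n) = map (inside ∷_) (allSubsets n) ++ map (outside ∷_) (allSubsets n)

nonemptySubsets : ∀ n → List (Subset n)
nonemptySubsets n = filter nonempty? (allSubsets n)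

subMat : ∀ {m n} → Mat m n → (J : Subset n) → Mat m (length (elems J))
subMat C J i a = C i (lookup (elems J) a)

augMat : ∀ {m n} → Mat m n → (Fin n → ℤ) → (J : Subset n) → Mat (m ℕ.+ 1) (length (elems J))
augMat {m} C b J i a = [ (λ i' → C i' (lookup (elems J) a)) , (λ _ → b (lookup (elems J) a)) ] (splitAt m i)

-- The constants ρ₀ and q*, computed from given invariants
-- rkC J = rank C_J, eC J = e(J), rkA J = rank A_J, eA J = e'(J)

maxℕ : List ℕ → ℕ
maxℕ = foldr _⊔_ 0

lcmList : List ℕ → ℕ
lcmList = foldr lcm 1

ρ₀ : ∀ {n} → (Subset n → ℕ) → ℕ
ρ₀ {n} eC = lcmList (map eC (nonemptySubsets n))

q₀ : ∀ {n} → (rkC rkA eA : Subset n → ℕ) → ℕ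
q₀ {n} rkC rkA eA =
  maxℕ (map eA (filter (λ J → rkA J ℕ.≟ suc (rkC J)) (nonemptySubsets n)))

q₁ : ∀ {n} → (rkC eC : Subset n → ℕ) → ℕ
q₁ {n} rkC eC =
  maxℕ (concatMap (λ j →
     map (λ J → eC (J ∪ ⁅ j ⁆))
       (filter (λ J → rkC (J ∪ ⁅ j ⁆) ℕ.≟ suc (rkC J)) (nonemptySubsets n)))
     (allFin n))

colGcd : ∀ {m n} → Mat m n → Fin n → ℕ
colGcd {m} C j = foldr gcd 0 (map (λ i → ∣ C i j ∣) (allFin m))

qStar : ∀ {m n} → Mat m n → (rkC eC rkA eA : Subset n → ℕ) → ℕ
qStar {m} {n} C rkC eC rkA eA =
  q₀ rkC rkA eA ⊔ q₁ rkC eC ⊔ maxℕ (map (colGcd C) (allFin n))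

-- z ∈ ℤ_q^m, represented by its entries in Fin q ≅ ℤ_q; [x]_q = [y]_q in ℤ_q
-- is expressed as q ∣ x - y in ℤ.

Vecq : ℕ → ℕ → Set
Vecq q m = Fin m → Fin q

dot : ∀ {q m n} → Vecq q m → Mat m n → Fin n → ℤ
dot z C j = Σℤ (λ i → + toℕ (z i) ℤ.* C i j)

InH : ∀ {m n} (q : ℕ) → Mat m n → (Fin n → ℤ) → Subset n → Vecq q m → Set
InH q C b J z = ∀ j → j ∈ J → (+ q) ℤD.∣ (dot z C j - b j)

-- H_{J,q} ≠ ∅, i.e. H_{J,q} ∈ L_q
InL : ∀ {m n} (q : ℕ) → Mat m n → (Fin n → ℤ) → Subset n → Set
InL {m} q C b J = ∃ λ (z : Vecq q m) → InH q C b J z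

-- H_{J1,q} ≤ H_{J2,q} in L_q (reverse inclusion: H_{J2,q} ⊆ H_{J1,q})
LeL : ∀ {m n} (q : ℕ) → Mat m n → (Fin n → ℤ) → Subset n → Subset n → Set
LeL {m} q C b J₁ J₂ = ∀ (z : Vecq q m) → InH q C b J₂ z → InH q C b J₁ z

IsoL : ∀ {m n} → Mat m n → (Fin n → ℤ) → ℕ → ℕ → Set
IsoL {m} {n} C b q q' =
  (∀ (J : Subset n) → (InL q C b J → InL q' C b J) × (InL q' C b J → InL q C b J))
  × (∀ (J₁ J₂ : Subset n) → InL q C b J₁ → InL q C b J₂ → InL q' C b J₁ → InL q' C b J₂ →
       (LeL q C b J₁ J₂ → LeL q' C b J₁ J₂) × (LeL q' C b J₁ J₂ → LeL q C b J₁ J₂))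

-- For q > q* the poset L_q is governed by divisibilities gcd(q, d) ∣ β with d an invariant factor of
-- some C_J; all of these divide ρ₀, and gcd(q, d) = gcd(gcd(ρ₀, q), d), so they only see gcd(ρ₀, q).
-- With U C_J V = D in Smith normal form:
--   H_{J,q} ≠ ∅ iff b_J V vanishes beyond rank C_J and gcd(q, d_a) ∣ (b_J V)_a below it. A nonzero
--   entry beyond the rank makes rank A_J = rank C_J + 1, and solvability mod q would then give
--   q ∣ e′(J) ≤ q₀ < q.
--   For H_{J₂,q} ≠ ∅, H_{J₂,q} ⊆ H_{J₁,q} iff for each j ∈ J₁ the set H_{J₂ ∪ {j},q} is nonempty and the
--   congruences of J₂ imply w c_j ≡ 0. The latter holds iff U c_j vanishes beyond the rank and
--   gcd(q, d_i) ∣ (U c_j)_i below it; here a nonzero entry beyond the rank would give q ∣ e(J₂ ∪ {j}) ≤ q₁,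
--   and J₂ = ∅ would make q divide the nonzero column c_j, whose gcd is at most q*.

module Submission where

open import Defs
open import Data.Nat as ℕ using (ℕ; zero; suc; z≤n; s≤s)
import Data.Nat.Properties as ℕP
import Data.Nat.Divisibility as ℕD
open import Data.Nat.GCD using (gcd; gcd[m,n]∣m; gcd[m,n]∣n; gcd-greatest; gcd-GCD; module Bézout)
open import Data.Nat.LCM using (m∣lcm[m,n]; n∣lcm[m,n])
open import Data.Integer as ℤ using (ℤ; +_; _+_; _*_; _-_; -_; 0ℤ; 1ℤ)
import Data.Integer.Properties as ℤP
open import Data.Integer.Divisibility.Signed as ℤD using (_∣_; divides)
open import Data.Integer.Tactic.RingSolver using (solve-∀)
open import Data.Fin as Fin using (Fin; toℕ; fromℕ<; punchIn; punchOut; splitAt; _↑ˡ_; _↑ʳ_)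
import Data.Fin.Properties as FinP
open import Data.Fin.Subset using (Subset; inside; outside; _∈_; _∪_; ⁅_⁆; Nonempty)
open import Data.Fin.Subset.Properties using (nonempty?; x∈p∪q⁺; x∈p∪q⁻; x∈⁅x⁆; x∈⁅y⁆⇒x≡y)
open import Data.Vec as Vec using ([]; _∷_)
open import Data.List as List using (List; []; _∷_; lookup; map; filter; allFin; foldr)
open import Data.List.Membership.Propositional using () renaming (_∈_ to _∈ₗ_)
import Data.List.Membership.Propositional.Properties as ∈ₗ
open import Data.List.Relation.Unary.Any as Any using (here; there)
import Data.List.Relation.Unary.Any.Properties as AnyP
open import Data.Bool using (true; false; T)
open import Data.Unit using (tt)
open import Data.Empty using (⊥-elim)
open import Data.Product using (∃; _×_; _,_; proj₁; proj₂)
open import Data.Sum using (_⊎_; inj₁; inj₂; [_,_]; [_,_]′)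
open import Function using (_∘_; id)
open import Relation.Nullary using (¬_; yes; no; ¬?)
open import Relation.Binary.PropositionalEquality using (_≡_; _≢_; refl; sym; trans; cong; cong₂; subst; module ≡-Reasoning)

Σ-cong : ∀ {k} {f g : Fin k → ℤ} → (∀ i → f i ≡ g i) → Σℤ f ≡ Σℤ g
Σ-cong {zero}  h = refl
Σ-cong {suc k} h = cong₂ _+_ (h Fin.zero) (Σ-cong (h ∘ Fin.suc))

Σ-zero : ∀ {k} {f : Fin k → ℤ} → (∀ i → f i ≡ 0ℤ) → Σℤ f ≡ 0ℤ
Σ-zero {zero}  h = refl
Σ-zero {suc k} h = cong₂ _+_ (h Fin.zero) (Σ-zero (h ∘ Fin.suc))

Σ-+ : ∀ {k} (f g : Fin k → ℤ) → Σℤ (λ i → f i + g i) ≡ Σℤ f + Σℤ g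
Σ-+ {zero}  f g = refl
Σ-+ {suc k} f g = trans (cong (_+_ (f Fin.zero + g Fin.zero)) (Σ-+ (f ∘ Fin.suc) (g ∘ Fin.suc)))
                        (interchange (f Fin.zero) (g Fin.zero) _ _)
  where interchange : ∀ a b c d → (a + b) + (c + d) ≡ (a + c) + (b + d)
        interchange = solve-∀

Σ-- : ∀ {k} (f g : Fin k → ℤ) → Σℤ (λ i → f i - g i) ≡ Σℤ f - Σℤ g
Σ-- {zero}  f g = refl
Σ-- {suc k} f g = trans (cong (_+_ (f Fin.zero - g Fin.zero)) (Σ-- (f ∘ Fin.suc) (g ∘ Fin.suc)))
                        (interchange (f Fin.zero) (g Fin.zero) _ _)
  where interchange : ∀ a b c d → (a - b) + (c - d) ≡ (a + c) - (b + d)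
        interchange = solve-∀

Σ-*ˡ : ∀ {k} (c : ℤ) (f : Fin k → ℤ) → Σℤ (λ i → c * f i) ≡ c * Σℤ f
Σ-*ˡ {zero}  c f = sym (ℤP.*-zeroʳ c)
Σ-*ˡ {suc k} c f = trans (cong (_+_ (c * f Fin.zero)) (Σ-*ˡ c (f ∘ Fin.suc)))
                         (sym (ℤP.*-distribˡ-+ c (f Fin.zero) _))

Σ-*ʳ : ∀ {k} (c : ℤ) (f : Fin k → ℤ) → Σℤ (λ i → f i * c) ≡ Σℤ f * c
Σ-*ʳ c f = trans (Σ-cong (λ i → ℤP.*-comm (f i) c)) (trans (Σ-*ˡ c f) (ℤP.*-comm c _))

Σ-swap : ∀ {k l} (f : Fin k → Fin l → ℤ) → Σℤ (λ i → Σℤ (f i)) ≡ Σℤ (λ j → Σℤ (λ i → f i j))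
Σ-swap {zero} {l} f = sym (Σ-zero {l} (λ _ → refl))
Σ-swap {suc k} f = trans (cong (_+_ (Σℤ (f Fin.zero))) (Σ-swap (f ∘ Fin.suc))) (sym (Σ-+ (f Fin.zero) _))

Σ-single : ∀ {k} (f : Fin k → ℤ) (i₀ : Fin k) → (∀ i → i ≢ i₀ → f i ≡ 0ℤ) → Σℤ f ≡ f i₀
Σ-single f Fin.zero h =
  trans (cong (_+_ (f Fin.zero)) (Σ-zero (λ i → h (Fin.suc i) λ ()))) (ℤP.+-identityʳ _)
Σ-single f (Fin.suc i₀) h =
  trans (cong (_+ Σℤ (f ∘ Fin.suc)) (h Fin.zero λ ()))
        (trans (ℤP.+-identityˡ _) (Σ-single (f ∘ Fin.suc) i₀ λ i i≢i₀ → h (Fin.suc i) (i≢i₀ ∘ FinP.suc-injective)))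

Σ-punchIn : ∀ {k} (f : Fin (suc k) → ℤ) t → Σℤ f ≡ f t + Σℤ (f ∘ punchIn t)
Σ-punchIn f Fin.zero = refl
Σ-punchIn {suc k} f (Fin.suc t) =
  trans (cong (_+_ (f Fin.zero)) (Σ-punchIn (f ∘ Fin.suc) t)) (swap (f Fin.zero) (f (Fin.suc t)) _)
  where swap : ∀ a b c → a + (b + c) ≡ b + (a + c)
        swap = solve-∀

∣-Σ : ∀ {k} {q : ℤ} (f : Fin k → ℤ) → (∀ i → q ∣ f i) → q ∣ Σℤ f
∣-Σ {zero}  f h = divides 0ℤ refl
∣-Σ {suc k} f h = ℤD.∣m∣n⇒∣m+n (h Fin.zero) (∣-Σ (f ∘ Fin.suc) (h ∘ Fin.suc))

ℤ^_ : ℕ → Set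
ℤ^ k = Fin k → ℤ

infixl 7 _⊙_
infix  8 _·_

_⊙_ : ∀ {p k} → ℤ^ p → Mat p k → ℤ^ k
(x ⊙ M) a = Σℤ (λ i → x i * M i a)

_·_ : ∀ {k} → ℤ^ k → ℤ^ k → ℤ
x · y = Σℤ (λ i → x i * y i)

⊙-· : ∀ {p k} (x : ℤ^ p) (A : Mat p k) (y : ℤ^ k) → (x ⊙ A) · y ≡ x · (λ i → A i · y)
⊙-· x A y = begin
  Σℤ (λ t → Σℤ (λ i → x i * A i t) * y t)   ≡⟨ Σ-cong (λ t → sym (Σ-*ʳ (y t) (λ i → x i * A i t))) ⟩
  Σℤ (λ t → Σℤ (λ i → x i * A i t * y t))   ≡⟨ Σ-cong (λ t → Σ-cong (λ i → ℤP.*-assoc (x i) (A i t) (y t))) ⟩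
  Σℤ (λ t → Σℤ (λ i → x i * (A i t * y t))) ≡⟨ sym (Σ-swap (λ i t → x i * (A i t * y t))) ⟩
  Σℤ (λ i → Σℤ (λ t → x i * (A i t * y t))) ≡⟨ Σ-cong (λ i → Σ-*ˡ (x i) (λ t → A i t * y t)) ⟩
  Σℤ (λ i → x i * A i · y)                  ∎
  where open ≡-Reasoning

⊙-assoc : ∀ {p k l} (x : ℤ^ p) (A : Mat p k) (B : Mat k l) c → ((x ⊙ A) ⊙ B) c ≡ (x ⊙ (A ⊗ B)) c
⊙-assoc x A B c = ⊙-· x A (λ t → B t c)

⊙-congˡ : ∀ {p k} {x y : ℤ^ p} (M : Mat p k) → (∀ i → x i ≡ y i) → ∀ a → (x ⊙ M) a ≡ (y ⊙ M) a
⊙-congˡ M h a = Σ-cong (λ i → cong (_* M i a) (h i))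

⊙-congʳ : ∀ {p k} (x : ℤ^ p) {M N : Mat p k} → (∀ i a → M i a ≡ N i a) → ∀ a → (x ⊙ M) a ≡ (x ⊙ N) a
⊙-congʳ x h a = Σ-cong (λ i → cong (x i *_) (h i a))

⊙-+ : ∀ {p k} (x y : ℤ^ p) (M : Mat p k) a → ((λ i → x i + y i) ⊙ M) a ≡ (x ⊙ M) a + (y ⊙ M) a
⊙-+ x y M a = trans (Σ-cong (λ i → ℤP.*-distribʳ-+ (M i a) (x i) (y i))) (Σ-+ (λ i → x i * M i a) (λ i → y i * M i a))

⊙-- : ∀ {p k} (x y : ℤ^ p) (M : Mat p k) a → ((λ i → x i - y i) ⊙ M) a ≡ (x ⊙ M) a - (y ⊙ M) a
⊙-- x y M a = trans (Σ-cong (λ i → distrib (x i) (y i) (M i a))) (Σ-- (λ i → x i * M i a) (λ i → y i * M i a))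
  where distrib : ∀ u v w → (u - v) * w ≡ u * w - v * w
        distrib = solve-∀

⊙-* : ∀ {p k} (c : ℤ) (x : ℤ^ p) (M : Mat p k) a → ((λ i → c * x i) ⊙ M) a ≡ c * (x ⊙ M) a
⊙-* c x M a = trans (Σ-cong (λ i → ℤP.*-assoc c (x i) (M i a))) (Σ-*ˡ c (λ i → x i * M i a))

⊙-zero : ∀ {p k} (M : Mat p k) a → ((λ _ → 0ℤ) ⊙ M) a ≡ 0ℤ
⊙-zero {p} M a = Σ-zero {p} (λ _ → refl)

∣-⊙ : ∀ {p k} {q : ℤ} (x : ℤ^ p) (M : Mat p k) → (∀ i → q ∣ x i) → ∀ a → q ∣ (x ⊙ M) a
∣-⊙ x M h a = ∣-Σ _ (λ i → ℤD.∣m⇒∣m*n (M i a) (h i))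

basis : ∀ {p} → Fin p → ℤ^ p
basis i₀ i with i Fin.≟ i₀
... | yes _ = 1ℤ
... | no  _ = 0ℤ

basis-self : ∀ {p} (i : Fin p) → basis i i ≡ 1ℤ
basis-self i with i Fin.≟ i
... | yes _   = refl
... | no  i≢i = ⊥-elim (i≢i refl)

basis-other : ∀ {p} (i₀ i : Fin p) → i ≢ i₀ → basis i₀ i ≡ 0ℤ
basis-other i₀ i i≢i₀ with i Fin.≟ i₀
... | yes i≡i₀ = ⊥-elim (i≢i₀ i≡i₀)
... | no  _    = refl

⊙-basis : ∀ {p k} (i₀ : Fin p) (M : Mat p k) a → (basis i₀ ⊙ M) a ≡ M i₀ a
⊙-basis i₀ M a =
  trans (Σ-single _ i₀ (λ i i≢i₀ → cong (_* M i a) (basis-other i₀ i i≢i₀)))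
        (trans (cong (_* M i₀ a) (basis-self i₀)) (ℤP.*-identityˡ _))

idMat-other : ∀ {p} (i a : Fin p) → i ≢ a → idMat i a ≡ 0ℤ
idMat-other i a i≢a with toℕ i ℕ.≡ᵇ toℕ a in eq
... | true  = ⊥-elim (i≢a (FinP.toℕ-injective (ℕP.≡ᵇ⇒≡ (toℕ i) (toℕ a) (subst T (sym eq) tt))))
... | false = refl

idMat-self : ∀ {p} (i : Fin p) → idMat i i ≡ 1ℤ
idMat-self i with toℕ i ℕ.≡ᵇ toℕ i in eq
... | true  = refl
... | false = ⊥-elim (subst T eq (ℕP.≡⇒≡ᵇ (toℕ i) (toℕ i) refl))

idMat-sym : ∀ {p} (i a : Fin p) → idMat i a ≡ idMat a i
idMat-sym i a with i Fin.≟ a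
... | yes refl = refl
... | no  i≢a  = trans (idMat-other i a i≢a) (sym (idMat-other a i (i≢a ∘ sym)))

⊙-idMat : ∀ {p} (x : ℤ^ p) a → (x ⊙ idMat) a ≡ x a
⊙-idMat x a =
  trans (Σ-single _ a (λ i i≢a → trans (cong (x i *_) (idMat-other i a i≢a)) (ℤP.*-zeroʳ (x i))))
        (trans (cong (x a *_) (idMat-self a)) (ℤP.*-identityʳ _))

⊙-inverse : ∀ {p k} (x : ℤ^ p) (A : Mat p k) (B : Mat k p) → (∀ i j → (A ⊗ B) i j ≡ idMat i j) →
            ∀ a → ((x ⊙ A) ⊙ B) a ≡ x a
⊙-inverse x A B AB≡I a = trans (⊙-assoc x A B a) (trans (⊙-congʳ x AB≡I a) (⊙-idMat x a))

i*j≡0∧i≢0⇒j≡0 : ∀ i {j} → i ≢ 0ℤ → i * j ≡ 0ℤ → j ≡ 0ℤ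
i*j≡0∧i≢0⇒j≡0 i i≢0 ij≡0 = [ ⊥-elim ∘ i≢0 , id ] (ℤP.i*j≡0⇒i≡0∨j≡0 i ij≡0)

i*j≡0∧j≢0⇒i≡0 : ∀ {i} j → j ≢ 0ℤ → i * j ≡ 0ℤ → i ≡ 0ℤ
i*j≡0∧j≢0⇒i≡0 {i} j j≢0 ij≡0 = i*j≡0∧i≢0⇒j≡0 j j≢0 (trans (ℤP.*-comm j i) ij≡0)

Dependent : ∀ {s k} → Mat s k → Set
Dependent v = ∃ λ l → (∃ λ t → l t ≢ 0ℤ) × (∀ a → (l ⊙ v) a ≡ 0ℤ)

LeftNull : ∀ {p k} → ℤ^ p → Mat p k → Set
LeftNull y M = ∀ a → (y ⊙ M) a ≡ 0ℤ

Independent : ∀ {s k} → Mat s k → Set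
Independent v = ∀ l → LeftNull l v → ∀ t → l t ≡ 0ℤ

-- Fraction-free elimination of the first column against the pivot row t₀.
module ClearFirstColumn {s k} (v : Mat (suc s) (suc k)) (t₀ : Fin (suc s)) (α≢0 : v t₀ Fin.zero ≢ 0ℤ) where

  α : ℤ
  α = v t₀ Fin.zero

  cleared : Mat s k
  cleared t a = α * v (punchIn t₀ t) (Fin.suc a) - v (punchIn t₀ t) Fin.zero * v t₀ (Fin.suc a)

  module _ (l′ : ℤ^ s) where
    σ : ℤ
    σ = Σℤ (λ t → l′ t * v (punchIn t₀ t) Fin.zero)

    lifted : ℤ^ suc s
    lifted t with t Fin.≟ t₀
    ... | yes _    = - σ
    ... | no  t≢t₀ = α * l′ (punchOut (t≢t₀ ∘ sym))

    lifted-t₀ : lifted t₀ ≡ - σ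
    lifted-t₀ with t₀ Fin.≟ t₀
    ... | yes _     = refl
    ... | no  t₀≢t₀ = ⊥-elim (t₀≢t₀ refl)

    lifted-punchIn : ∀ t → lifted (punchIn t₀ t) ≡ α * l′ t
    lifted-punchIn t with punchIn t₀ t Fin.≟ t₀
    ... | yes eq = ⊥-elim (FinP.punchInᵢ≢i t₀ t eq)
    ... | no  _  = cong (λ i → α * l′ i) (trans (FinP.punchOut-cong t₀ refl) (FinP.punchOut-punchIn t₀))

    lifted⊙v : ∀ a → (lifted ⊙ v) a ≡ - σ * v t₀ a + α * Σℤ (λ t → l′ t * v (punchIn t₀ t) a)
    lifted⊙v a = trans (Σ-punchIn (λ t → lifted t * v t a) t₀)
      (cong₂ _+_ (cong (_* v t₀ a) lifted-t₀)
        (trans (Σ-cong (λ t → trans (cong (_* v (punchIn t₀ t) a) (lifted-punchIn t)) (ℤP.*-assoc α (l′ t) _)))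
               (Σ-*ˡ α (λ t → l′ t * v (punchIn t₀ t) a))))

    l′⊙cleared : ∀ a → (l′ ⊙ cleared) a
                     ≡ α * Σℤ (λ t → l′ t * v (punchIn t₀ t) (Fin.suc a)) - σ * v t₀ (Fin.suc a)
    l′⊙cleared a =
      trans (Σ-cong (λ t → distrib (l′ t) α (v (punchIn t₀ t) (Fin.suc a)) (v (punchIn t₀ t) Fin.zero) (v t₀ (Fin.suc a))))
        (trans (Σ-- (λ t → α * (l′ t * v (punchIn t₀ t) (Fin.suc a))) (λ t → (l′ t * v (punchIn t₀ t) Fin.zero) * v t₀ (Fin.suc a)))
          (cong₂ _-_ (Σ-*ˡ α (λ t → l′ t * v (punchIn t₀ t) (Fin.suc a)))
                     (Σ-*ʳ (v t₀ (Fin.suc a)) (λ t → l′ t * v (punchIn t₀ t) Fin.zero))))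
      where distrib : ∀ L A V U X → L * (A * V - U * X) ≡ A * (L * V) - (L * U) * X
            distrib = solve-∀

  lift : Dependent cleared → Dependent v
  lift (l′ , (t₁ , l′t₁≢0) , l′cleared≡0) = lifted l′ , (punchIn t₀ t₁ , lifted≢0) , lifted⊙v≡0
    where
    lifted≢0 : lifted l′ (punchIn t₀ t₁) ≢ 0ℤ
    lifted≢0 eq = [ α≢0 , l′t₁≢0 ] (ℤP.i*j≡0⇒i≡0∨j≡0 α (trans (sym (lifted-punchIn l′ t₁)) eq))

    lifted⊙v≡0 : ∀ a → (lifted l′ ⊙ v) a ≡ 0ℤ
    lifted⊙v≡0 Fin.zero    = trans (lifted⊙v l′ Fin.zero) (cancel (σ l′) α)
      where cancel : ∀ S A → - S * A + A * S ≡ 0ℤ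
            cancel = solve-∀
    lifted⊙v≡0 (Fin.suc a) = trans (lifted⊙v l′ (Fin.suc a)) (trans (reorder (σ l′) (v t₀ (Fin.suc a)) α _)
                               (trans (sym (l′⊙cleared l′ a)) (l′cleared≡0 a)))
      where reorder : ∀ S X A T → - S * X + A * T ≡ A * T - S * X
            reorder = solve-∀

dependent : ∀ {k s} → k ℕ.< s → (v : Mat s k) → Dependent v
dependent {zero}  {suc s} _ v = (λ _ → 1ℤ) , (Fin.zero , λ ()) , λ ()
dependent {suc k} {suc s} (s≤s k<s) v with FinP.any? (λ t → ¬? (v t Fin.zero ℤ.≟ 0ℤ))
... | yes (t₀ , α≢0) = ClearFirstColumn.lift v t₀ α≢0 (dependent k<s (ClearFirstColumn.cleared v t₀ α≢0))
... | no  noPivot    = l , l≢0 , lv≡0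
  where
  firstColumn≡0 : ∀ t → v t Fin.zero ≡ 0ℤ
  firstColumn≡0 t with v t Fin.zero ℤ.≟ 0ℤ
  ... | yes eq  = eq
  ... | no  neq = ⊥-elim (noPivot (t , neq))

  rest = dependent (ℕP.m<n⇒m<1+n k<s) (λ t a → v t (Fin.suc a))
  l = proj₁ rest
  l≢0 = proj₁ (proj₂ rest)

  lv≡0 : ∀ a → (l ⊙ v) a ≡ 0ℤ
  lv≡0 Fin.zero    = Σ-zero (λ t → trans (cong (l t *_) (firstColumn≡0 t)) (ℤP.*-zeroʳ (l t)))
  lv≡0 (Fin.suc a) = proj₂ (proj₂ rest) a

independent⇒≤ : ∀ {s k} (v : Mat s k) → Independent v → s ℕ.≤ k
independent⇒≤ {s} {k} v indep with s ℕP.≤? k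
... | yes s≤k = s≤k
... | no  s≰k with dependent (ℕP.≰⇒> s≰k) v
...   | l , (t , lt≢0) , lv≡0 = ⊥-elim (lt≢0 (indep l lv≡0 t))

∣0ℤ : ∀ {q} → q ∣ 0ℤ
∣0ℤ = divides 0ℤ refl

pos-+-* : ∀ a b c d e → a ℕ.+ b ℕ.* c ≡ d ℕ.* e → + a + + b * + c ≡ + d * + e
pos-+-* a b c d e eq =
  trans (cong (_+_ (+ a)) (sym (ℤP.pos-* b c))) (trans (sym (ℤP.pos-+ a (b ℕ.* c))) (trans (cong +_ eq) (ℤP.pos-* d e)))

bézout : ∀ q d → ∃ λ X → ∃ λ Y → + gcd q d ≡ X * + q + Y * + d
bézout q d with Bézout.identity (gcd-GCD q d)
... | Bézout.+- x y eq = + x , - + y , rearrange (+ gcd q d) (+ x) (+ y) (+ q) (+ d) (pos-+-* (gcd q d) y d x q eq)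
  where
  rearrange : ∀ G X Y Q D → G + Y * D ≡ X * Q → G ≡ X * Q + (- Y) * D
  rearrange G X Y Q D h = trans (undo G (Y * D)) (trans (cong (_- Y * D) h) (minus X Q Y D))
    where undo : ∀ a b → a ≡ (a + b) - b
          undo = solve-∀
          minus : ∀ X Q Y D → X * Q - Y * D ≡ X * Q + (- Y) * D
          minus = solve-∀
... | Bézout.-+ x y eq = - + x , + y , rearrange (+ gcd q d) (+ x) (+ y) (+ q) (+ d) (pos-+-* (gcd q d) x q y d eq)
  where
  rearrange : ∀ G X Y Q D → G + X * Q ≡ Y * D → G ≡ (- X) * Q + Y * D
  rearrange G X Y Q D h = trans (undo G (X * Q)) (trans (cong (_- X * Q) h) (minus X Q Y D))
    where undo : ∀ a b → a ≡ (a + b) - b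
          undo = solve-∀
          minus : ∀ X Q Y D → Y * D - X * Q ≡ (- X) * Q + Y * D
          minus = solve-∀

∣w*d-β⇒gcd∣β : ∀ q d β w → + q ∣ w * + d - β → + gcd q d ∣ β
∣w*d-β⇒gcd∣β q d β w q∣wd-β = subst (_ ∣_) (cancel w (+ d) β)
    (ℤD.∣m∣n⇒∣m-n (ℤD.∣n⇒∣m*n w (ℤD.∣ᵤ⇒∣ (gcd[m,n]∣n q d))) (ℤD.∣-trans (ℤD.∣ᵤ⇒∣ (gcd[m,n]∣m q d)) q∣wd-β))
  where cancel : ∀ w D β → w * D - (w * D - β) ≡ β
        cancel = solve-∀

gcd∣β⇒∃w : ∀ q d β → + gcd q d ∣ β → ∃ λ w → + q ∣ w * + d - β
gcd∣β⇒∃w q d β (divides h β≡hg) with bézout q d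
... | X , Y , g≡ = h * Y , divides (- (h * X)) (trans (cong (λ t → h * Y * + d - t) (trans β≡hg (cong (h *_) g≡)))
                                                       (expand h X Y (+ q) (+ d)))
  where expand : ∀ h X Y Q D → h * Y * D - h * (X * Q + Y * D) ≡ (- (h * X)) * Q
        expand = solve-∀

gcd∣u⇒∣y*u : ∀ q d u → + gcd q d ∣ u → ∀ y → + q ∣ y * + d → + q ∣ y * u
gcd∣u⇒∣y*u q d u (divides h u≡hg) y q∣yd with bézout q d
... | X , Y , g≡ = subst (+ q ∣_) (sym (trans (cong (y *_) (trans u≡hg (cong (h *_) g≡))) (expand y h X Y (+ q) (+ d))))
                     (ℤD.∣m∣n⇒∣m+n (ℤD.∣n⇒∣m*n (y * h * X) ℤD.∣-refl) (ℤD.∣n⇒∣m*n (h * Y) q∣yd))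
  where expand : ∀ y h X Y Q D → y * (h * (X * Q + Y * D)) ≡ y * h * X * Q + h * Y * (y * D)
        expand = solve-∀

[∣y*d⇒∣y*u]⇒gcd∣u : ∀ q d u → 0 ℕ.< q → (∀ y → + q ∣ y * + d → + q ∣ y * u) → + gcd q d ∣ u
[∣y*d⇒∣y*u]⇒gcd∣u q d u 0<q annihilates with gcd[m,n]∣m q d | gcd[m,n]∣n q d
... | ℕD.divides q₁ q≡q₁g | ℕD.divides d₁ d≡d₁g = cancel q₁ q≡q₁g (annihilates (+ q₁) q∣q₁d)
  where
  g = gcd q d
  -- q₁ = q / gcd q d annihilates d modulo q
  q∣q₁d : + q ∣ + q₁ * + d
  q∣q₁d = divides (+ d₁) (trans (sym (ℤP.pos-* q₁ d)) (trans (cong +_ q₁d≡d₁q) (ℤP.pos-* d₁ q)))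
    where q₁d≡d₁q : q₁ ℕ.* d ≡ d₁ ℕ.* q
          q₁d≡d₁q = trans (cong (q₁ ℕ.*_) d≡d₁g) (trans (ℕP.*-comm q₁ _) (trans (ℕP.*-assoc d₁ g q₁)
                      (cong (d₁ ℕ.*_) (trans (ℕP.*-comm g q₁) (sym q≡q₁g)))))
  cancel : ∀ q₁ → q ≡ q₁ ℕ.* g → + q ∣ + q₁ * u → + g ∣ u
  cancel zero      q≡0 _ = ⊥-elim (ℕP.<⇒≢ 0<q (sym q≡0))
  cancel (suc q₁′) q≡q₁g (divides t q₁u≡tq) = divides t (ℤP.*-cancelˡ-≡ (+ suc q₁′) u (t * + g)
      (trans q₁u≡tq (trans (cong (t *_) (trans (cong +_ q≡q₁g) (ℤP.pos-* (suc q₁′) g))) (swap t (+ suc q₁′) (+ g)))))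
    where swap : ∀ t a b → t * (a * b) ≡ a * (t * b)
          swap = solve-∀

gcd-factor-through : ∀ q d ρ → d ℕD.∣ ρ → gcd q d ≡ gcd (gcd ρ q) d
gcd-factor-through q d ρ d∣ρ = ℕD.∣-antisym
  (gcd-greatest (gcd-greatest (ℕD.∣-trans (gcd[m,n]∣n q d) d∣ρ) (gcd[m,n]∣m q d)) (gcd[m,n]∣n q d))
  (gcd-greatest (ℕD.∣-trans (gcd[m,n]∣m (gcd ρ q) d) (gcd[m,n]∣n ρ q)) (gcd[m,n]∣n (gcd ρ q) d))

gcd[ρ,q]≡gcd[ρ,q+ρ] : ∀ q ρ → gcd ρ q ≡ gcd ρ (q ℕ.+ ρ)
gcd[ρ,q]≡gcd[ρ,q+ρ] q ρ = ℕD.∣-antisym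
  (gcd-greatest (gcd[m,n]∣m ρ q) (ℕD.∣m∣n⇒∣m+n (gcd[m,n]∣n ρ q) (gcd[m,n]∣m ρ q)))
  (gcd-greatest (gcd[m,n]∣m ρ (q ℕ.+ ρ))
     (ℕD.∣m+n∣m⇒∣n (subst (gcd ρ (q ℕ.+ ρ) ℕD.∣_) (ℕP.+-comm q ρ) (gcd[m,n]∣n ρ (q ℕ.+ ρ))) (gcd[m,n]∣m ρ (q ℕ.+ ρ))))

invariantFactor∣lastFactor : ∀ (d : ℕ → ℕ) r → (∀ i → suc i ℕ.< r → d i ℕD.∣ d (suc i)) →
                             ∀ i → i ℕ.< r → d i ℕD.∣ lastFactor r d
invariantFactor∣lastFactor d (suc r) ddiv i (s≤s i≤r) = chain r i≤r ℕP.≤-refl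
  where
  chain : ∀ {i} j → i ℕ.≤ j → j ℕ.< suc r → d i ℕD.∣ d j
  chain zero    z≤n _ = ℕD.∣-refl
  chain (suc j) i≤1+j 1+j<1+r with ℕP.m≤n⇒m<n∨m≡n i≤1+j
  ... | inj₂ refl       = ℕD.∣-refl
  ... | inj₁ (s≤s i≤j) = ℕD.∣-trans (chain j i≤j (ℕP.<-trans (ℕP.n<1+n j) 1+j<1+r)) (ddiv j 1+j<1+r)

-- Consequences of a Smith normal form U M V = D

_∈RowLattice_ : ∀ {p k} → ℤ^ k → Mat p k → Set
y ∈RowLattice M = ∃ λ x → ∀ a → y a ≡ (x ⊙ M) a

SolvableMod : ∀ {p k} → ℕ → Mat p k → ℤ^ k → Set
SolvableMod {p} q M b = ∃ λ (z : ℤ^ p) → ∀ a → + q ∣ (z ⊙ M) a - b a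

ImpliedMod : ∀ {p k} → ℕ → Mat p k → ℤ^ p → Set
ImpliedMod {p} q M c = ∀ (w : ℤ^ p) → (∀ a → + q ∣ (w ⊙ M) a) → + q ∣ w · c

module SmithForm {p k : ℕ} {M : Mat p k} {r e : ℕ} (S : SNF M r e) where
  open SNF S public

  D : Mat p k
  D = diagMat r d

  embedₖ : Fin r → Fin k
  embedₖ t = fromℕ< (ℕP.<-≤-trans (FinP.toℕ<n t) r≤k)

  embedₚ : Fin r → Fin p
  embedₚ t = fromℕ< (ℕP.<-≤-trans (FinP.toℕ<n t) r≤p)

  embedₖ-fromℕ< : ∀ b (b<r : toℕ b ℕ.< r) → embedₖ (fromℕ< b<r) ≡ b
  embedₖ-fromℕ< b b<r = FinP.toℕ-injective (trans (FinP.toℕ-fromℕ< _) (FinP.toℕ-fromℕ< _))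

  rowAt : (a : Fin k) → toℕ a ℕ.< r → Fin p
  rowAt a a<r = fromℕ< (ℕP.<-≤-trans a<r r≤p)

  colAt : (i : Fin p) → toℕ i ℕ.< r → Fin k
  colAt i i<r = fromℕ< (ℕP.<-≤-trans i<r r≤k)

  ⊙UMV : ∀ (y : ℤ^ p) a → (((y ⊙ U) ⊙ M) ⊙ V) a ≡ (y ⊙ D) a
  ⊙UMV y a = trans (⊙-congˡ V (⊙-assoc y U M) a) (trans (⊙-assoc y (U ⊗ M) V a) (⊙-congʳ y diag a))

  ⊙MV : ∀ (x : ℤ^ p) a → ((x ⊙ M) ⊙ V) a ≡ ((x ⊙ U') ⊙ D) a
  ⊙MV x a = trans (⊙-congˡ V (⊙-congˡ M (λ i → sym (⊙-inverse x U' U U'U i))) a) (⊙UMV (x ⊙ U') a)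

  D-off : ∀ i a → toℕ i ≢ toℕ a ⊎ r ℕ.≤ toℕ i → D i a ≡ 0ℤ
  D-off i a off with toℕ i ℕ.≡ᵇ toℕ a in e₁ | toℕ i ℕ.<ᵇ r in e₂
  ... | true  | true  = ⊥-elim ([ (λ i≢a → i≢a (ℕP.≡ᵇ⇒≡ _ _ (subst T (sym e₁) tt)))
                              , ℕP.<⇒≱ (ℕP.<ᵇ⇒< _ _ (subst T (sym e₂) tt)) ] off)
  ... | true  | false = refl
  ... | false | _     = refl

  D-on : ∀ i a → toℕ i ≡ toℕ a → toℕ a ℕ.< r → D i a ≡ + d (toℕ i)
  D-on i a i≡a a<r with toℕ i ℕ.≡ᵇ toℕ a in e₁ | toℕ i ℕ.<ᵇ r in e₂
  ... | true  | true  = refl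
  ... | true  | false = ⊥-elim (subst T e₂ (ℕP.<⇒<ᵇ (subst (ℕ._< r) (sym i≡a) a<r)))
  ... | false | _     = ⊥-elim (subst T e₁ (ℕP.≡⇒≡ᵇ _ _ i≡a))

  ⊙D-beyond : ∀ (y : ℤ^ p) a → r ℕ.≤ toℕ a → (y ⊙ D) a ≡ 0ℤ
  ⊙D-beyond y a r≤a = Σ-zero (λ i → trans (cong (y i *_) (D-off i a (off i))) (ℤP.*-zeroʳ (y i)))
    where off : ∀ i → toℕ i ≢ toℕ a ⊎ r ℕ.≤ toℕ i
          off i with toℕ i ℕ.≟ toℕ a
          ... | yes i≡a = inj₂ (subst (r ℕ.≤_) (sym i≡a) r≤a)
          ... | no  i≢a = inj₁ i≢a

  ⊙D-on : ∀ (y : ℤ^ p) i a → toℕ i ≡ toℕ a → toℕ a ℕ.< r → (y ⊙ D) a ≡ y i * + d (toℕ i)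
  ⊙D-on y i a i≡a a<r =
    trans (Σ-single _ i (λ i′ i′≢i → trans (cong (y i′ *_) (D-off i′ a (inj₁ (λ eq → i′≢i (FinP.toℕ-injective (trans eq (sym i≡a)))))))
                                           (ℤP.*-zeroʳ (y i′))))
          (cong (y i *_) (D-on i a i≡a a<r))

  ⊙D-below : ∀ (y : ℤ^ p) a (a<r : toℕ a ℕ.< r) → (y ⊙ D) a ≡ y (rowAt a a<r) * + d (toℕ a)
  ⊙D-below y a a<r = trans (⊙D-on y (rowAt a a<r) a (FinP.toℕ-fromℕ< _) a<r)
                           (cong (λ t → y (rowAt a a<r) * + d t) (FinP.toℕ-fromℕ< _))

  ⊙V≡0⇒≡0 : ∀ (z : ℤ^ k) → (∀ b → (z ⊙ V) b ≡ 0ℤ) → ∀ a → z a ≡ 0ℤ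
  ⊙V≡0⇒≡0 z zV≡0 a = trans (sym (⊙-inverse z V V' VV' a)) (trans (⊙-congˡ V' zV≡0 a) (⊙-zero V' a))

  U-beyond-rank : ∀ i → r ℕ.≤ toℕ i → ∀ a → (U i ⊙ M) a ≡ 0ℤ
  U-beyond-rank i r≤i = ⊙V≡0⇒≡0 (U i ⊙ M) (λ b →
      trans (⊙-congˡ V (⊙-congˡ M (λ l → sym (⊙-basis i U l))) b) (trans (⊙UMV (basis i) b) (basis⊙D b)))
    where
    basis⊙D : ∀ b → (basis i ⊙ D) b ≡ 0ℤ
    basis⊙D b with toℕ b ℕ.<? r
    ... | no  b≮r = ⊙D-beyond (basis i) b (ℕP.≮⇒≥ b≮r)
    ... | yes b<r = trans (⊙D-below (basis i) b b<r)
                          (cong (_* + d (toℕ b)) (basis-other i (rowAt b b<r) (λ eq → ℕP.<⇒≱ b<r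
                            (subst (r ℕ.≤_) (trans (cong toℕ (sym eq)) (FinP.toℕ-fromℕ< _)) r≤i))))

  d∣e : ∀ i → i ℕ.< r → d i ℕD.∣ e
  d∣e i i<r = subst (d i ℕD.∣_) (sym last) (invariantFactor∣lastFactor d r ddiv i i<r)

  e>0 : 0 ℕ.< r → 0 ℕ.< e
  e>0 (s≤s _) = subst (0 ℕ.<_) (sym last) (dpos _ ℕP.≤-refl)

  spread : ℤ^ k → ℤ^ p
  spread ω i with toℕ i ℕ.<? r
  ... | yes i<r = ω (colAt i i<r)
  ... | no  _   = 0ℤ

  spread⊙D : ∀ ω a → toℕ a ℕ.< r → (spread ω ⊙ D) a ≡ ω a * + d (toℕ a)
  spread⊙D ω a a<r = trans (⊙D-below (spread ω) a a<r) (cong (_* + d (toℕ a)) spread-at)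
    where
    spread-at : spread ω (rowAt a a<r) ≡ ω a
    spread-at with toℕ (rowAt a a<r) ℕ.<? r
    ... | yes _  = cong ω (FinP.toℕ-injective (trans (FinP.toℕ-fromℕ< _) (FinP.toℕ-fromℕ< _)))
    ... | no  ≮r = ⊥-elim (≮r (subst (ℕ._< r) (sym (FinP.toℕ-fromℕ< _)) a<r))

  -- In the basis V the torsion of ℤᵏ / rows(M) is ⊕ ℤ/dᵢ, and e is a common multiple of the dᵢ.
  lastFactor-kills-torsion : ∀ c (y : ℤ^ k) → c ≢ 0ℤ → (λ a → c * y a) ∈RowLattice M → (λ a → + e * y a) ∈RowLattice M
  lastFactor-kills-torsion c y c≢0 (x , cy≡xM) = spread ω ⊙ U , λ a → sym (eyV a)
    where
    β : ℤ^ k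
    β = y ⊙ V

    cβ : ∀ a → c * β a ≡ ((x ⊙ U') ⊙ D) a
    cβ a = trans (sym (⊙-* c y V a)) (trans (⊙-congˡ V cy≡xM a) (⊙MV x a))

    β-beyond : ∀ a → r ℕ.≤ toℕ a → β a ≡ 0ℤ
    β-beyond a r≤a = i*j≡0∧i≢0⇒j≡0 c c≢0 (trans (cβ a) (⊙D-beyond (x ⊙ U') a r≤a))

    ω : ℤ^ k
    ω a with toℕ a ℕ.<? r
    ... | yes a<r = + ℕD.quotient (d∣e (toℕ a) a<r) * β a
    ... | no  _   = 0ℤ

    ωd : ∀ a → toℕ a ℕ.< r → ω a * + d (toℕ a) ≡ + e * β a
    ωd a a<r with toℕ a ℕ.<? r
    ... | no  a≮r = ⊥-elim (a≮r a<r)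
    ... | yes a<r′ = trans (swap (+ ℕD.quotient dₐ∣e) (β a) (+ d (toℕ a)))
                           (cong (_* β a) (trans (sym (ℤP.pos-* (ℕD.quotient dₐ∣e) (d (toℕ a))))
                                                 (cong +_ (sym (ℕD._∣_.equality dₐ∣e)))))
      where dₐ∣e = d∣e (toℕ a) a<r′
            swap : ∀ F B E → F * B * E ≡ F * E * B
            swap = solve-∀

    spreadω⊙D : ∀ a → (spread ω ⊙ D) a ≡ + e * β a
    spreadω⊙D a with toℕ a ℕ.<? r
    ... | yes a<r = trans (spread⊙D ω a a<r) (ωd a a<r)
    ... | no  a≮r = trans (⊙D-beyond (spread ω) a (ℕP.≮⇒≥ a≮r))
                          (sym (trans (cong (+ e *_) (β-beyond a (ℕP.≮⇒≥ a≮r))) (ℤP.*-zeroʳ (+ e))))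

    eyV : ∀ a → (((spread ω ⊙ U) ⊙ M)) a ≡ + e * y a
    eyV a = trans (sym (⊙-inverse ((spread ω ⊙ U) ⊙ M) V V' VV' a))
                  (trans (⊙-congˡ V' (λ b → trans (⊙UMV (spread ω) b) (spreadω⊙D b)) a)
                         (trans (⊙-* (+ e) β V' a) (cong (+ e *_) (⊙-inverse y V V' VV' a))))

  ⊙M≡0-from-leading : ∀ (y : ℤ^ p) → (∀ b → toℕ b ℕ.< r → ((y ⊙ M) ⊙ V) b ≡ 0ℤ) → ∀ a → (y ⊙ M) a ≡ 0ℤ
  ⊙M≡0-from-leading y leading≡0 = ⊙V≡0⇒≡0 (y ⊙ M) yMV≡0
    where yMV≡0 : ∀ b → ((y ⊙ M) ⊙ V) b ≡ 0ℤ
          yMV≡0 b with toℕ b ℕ.<? r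
          ... | yes b<r = leading≡0 b b<r
          ... | no  b≮r = trans (⊙MV y b) (⊙D-beyond (y ⊙ U') b (ℕP.≮⇒≥ b≮r))

  independent⇒≤rank : ∀ {s} (y : Mat s p) → Independent (y ⊗ M) → s ℕ.≤ r
  independent⇒≤rank y indep = independent⇒≤ (y ⊗ P) λ l lyP≡0 →
      indep l (λ a → trans (sym (⊙-assoc l y M a)) (⊙M≡0-from-leading (l ⊙ y) (leading l lyP≡0) a))
    where
    P : Mat p r
    P i b = (M ⊗ V) i (embedₖ b)

    leading : ∀ l → (∀ b → (l ⊙ (y ⊗ P)) b ≡ 0ℤ) → ∀ b → toℕ b ℕ.< r → (((l ⊙ y) ⊙ M) ⊙ V) b ≡ 0ℤ
    leading l lyP≡0 b b<r = begin
      (((l ⊙ y) ⊙ M) ⊙ V) b              ≡⟨ ⊙-assoc (l ⊙ y) M V b ⟩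
      ((l ⊙ y) ⊙ (M ⊗ V)) b              ≡⟨ cong ((l ⊙ y) ⊙ (M ⊗ V)) (sym (embedₖ-fromℕ< b b<r)) ⟩
      ((l ⊙ y) ⊙ P) (fromℕ< b<r)         ≡⟨ ⊙-assoc l y P (fromℕ< b<r) ⟩
      (l ⊙ (y ⊗ P)) (fromℕ< b<r)         ≡⟨ lyP≡0 (fromℕ< b<r) ⟩
      0ℤ                                 ∎
      where open ≡-Reasoning

  leadingRows : Mat r p
  leadingRows t = U (embedₚ t)

  leadingRows-independent : Independent (leadingRows ⊗ M)
  leadingRows-independent l l⊙≡0 t₀ = i*j≡0∧j≢0⇒i≡0 (+ d (toℕ t₀)) dₜ≢0 lₜd≡0
    where
    dₜ≢0 : + d (toℕ t₀) ≢ 0ℤ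
    dₜ≢0 eq = ℕP.<⇒≢ (dpos (toℕ t₀) (FinP.toℕ<n t₀)) (sym (ℤP.+-injective eq))

    L : ℤ^ p
    L = l ⊙ (λ t → basis (embedₚ t))

    L⊙U : ∀ i → (L ⊙ U) i ≡ (l ⊙ leadingRows) i
    L⊙U i = trans (⊙-assoc l _ U i) (Σ-cong (λ t → cong (l t *_) (⊙-basis (embedₚ t) U i)))

    embedₚ-injective : ∀ {t t′} → embedₚ t ≡ embedₚ t′ → t ≡ t′
    embedₚ-injective eq = FinP.toℕ-injective (trans (sym (FinP.toℕ-fromℕ< _)) (trans (cong toℕ eq) (FinP.toℕ-fromℕ< _)))

    L-at : L (embedₚ t₀) ≡ l t₀
    L-at = trans (Σ-single _ t₀ (λ t t≢t₀ → trans (cong (l t *_) (basis-other (embedₚ t) (embedₚ t₀) (t≢t₀ ∘ sym ∘ embedₚ-injective)))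
                                                  (ℤP.*-zeroʳ (l t))))
                 (trans (cong (l t₀ *_) (basis-self (embedₚ t₀))) (ℤP.*-identityʳ (l t₀)))

    lₜd≡0 : l t₀ * + d (toℕ t₀) ≡ 0ℤ
    lₜd≡0 = begin
      l t₀ * + d (toℕ t₀)                          ≡⟨ cong₂ (λ x t → x * + d t) (sym L-at) (sym (FinP.toℕ-fromℕ< _)) ⟩
      L (embedₚ t₀) * + d (toℕ (embedₚ t₀))        ≡⟨ sym (⊙D-on L (embedₚ t₀) (embedₖ t₀) same-index embedₖ<r) ⟩
      (L ⊙ D) (embedₖ t₀)                          ≡⟨ sym (⊙UMV L (embedₖ t₀)) ⟩
      (((L ⊙ U) ⊙ M) ⊙ V) (embedₖ t₀)              ≡⟨ ⊙-congˡ V (⊙-congˡ M L⊙U) (embedₖ t₀) ⟩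
      (((l ⊙ leadingRows) ⊙ M) ⊙ V) (embedₖ t₀)    ≡⟨ ⊙-congˡ V (λ a → trans (⊙-assoc l leadingRows M a) (l⊙≡0 a)) (embedₖ t₀) ⟩
      ((λ _ → 0ℤ) ⊙ V) (embedₖ t₀)                 ≡⟨ ⊙-zero V (embedₖ t₀) ⟩
      0ℤ                                           ∎
      where open ≡-Reasoning
            same-index : toℕ (embedₚ t₀) ≡ toℕ (embedₖ t₀)
            same-index = trans (FinP.toℕ-fromℕ< _) (sym (FinP.toℕ-fromℕ< _))
            embedₖ<r : toℕ (embedₖ t₀) ℕ.< r
            embedₖ<r = subst (ℕ._< r) (sym (FinP.toℕ-fromℕ< _)) (FinP.toℕ<n t₀)

  solvable⇒gcd∣ : ∀ q b → SolvableMod q M b → ∀ a (a<r : toℕ a ℕ.< r) → + gcd q (d (toℕ a)) ∣ (b ⊙ V) a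
  solvable⇒gcd∣ q b (z , q∣zM-b) a a<r = ∣w*d-β⇒gcd∣β q (d (toℕ a)) ((b ⊙ V) a) ((z ⊙ U') (rowAt a a<r))
    (subst (_ ∣_) (trans (⊙-- (z ⊙ M) b V a) (cong (_- (b ⊙ V) a) (trans (⊙MV z a) (⊙D-below (z ⊙ U') a a<r))))
           (∣-⊙ _ V q∣zM-b a))

  gcd∣⇒solvable : ∀ q b → (∀ a → r ℕ.≤ toℕ a → (b ⊙ V) a ≡ 0ℤ) →
                  (∀ a (a<r : toℕ a ℕ.< r) → + gcd q (d (toℕ a)) ∣ (b ⊙ V) a) → SolvableMod q M b
  gcd∣⇒solvable q b β-beyond gcd∣β = spread ω ⊙ U , λ a → subst (_ ∣_) (⊙-inverse x V V' VV' a) (∣-⊙ (x ⊙ V) V' q∣xV a)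
    where
    ω : ℤ^ k
    ω a with toℕ a ℕ.<? r
    ... | yes a<r = proj₁ (gcd∣β⇒∃w q (d (toℕ a)) ((b ⊙ V) a) (gcd∣β a a<r))
    ... | no  _   = 0ℤ

    q∣ωd-β : ∀ a (a<r : toℕ a ℕ.< r) → + q ∣ ω a * + d (toℕ a) - (b ⊙ V) a
    q∣ωd-β a a<r with toℕ a ℕ.<? r
    ... | yes a<r′ = proj₂ (gcd∣β⇒∃w q (d (toℕ a)) ((b ⊙ V) a) (gcd∣β a a<r′))
    ... | no  a≮r  = ⊥-elim (a≮r a<r)

    x : ℤ^ k
    x a = ((spread ω ⊙ U) ⊙ M) a - b a

    xV : ∀ a → (x ⊙ V) a ≡ (spread ω ⊙ D) a - (b ⊙ V) a
    xV a = trans (⊙-- ((spread ω ⊙ U) ⊙ M) b V a) (cong (_- (b ⊙ V) a) (⊙UMV (spread ω) a))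

    q∣xV : ∀ a → + q ∣ (x ⊙ V) a
    q∣xV a with toℕ a ℕ.<? r
    ... | yes a<r = subst (_ ∣_) (sym (trans (xV a) (cong (_- (b ⊙ V) a) (spread⊙D ω a a<r)))) (q∣ωd-β a a<r)
    ... | no  a≮r = subst (_ ∣_) (sym (trans (xV a) (cong₂ _-_ (⊙D-beyond (spread ω) a (ℕP.≮⇒≥ a≮r))
                                                                (β-beyond a (ℕP.≮⇒≥ a≮r))))) ∣0ℤ

  ∈RowLattice⇒beyond-rank : ∀ c (b : ℤ^ k) → (λ a → c * b a) ∈RowLattice M → ∀ a → r ℕ.≤ toℕ a → c * (b ⊙ V) a ≡ 0ℤ
  ∈RowLattice⇒beyond-rank c b (x , cb≡xM) a r≤a =
    trans (sym (⊙-* c b V a)) (trans (⊙-congˡ V cb≡xM a) (trans (⊙MV x a) (⊙D-beyond (x ⊙ U') a r≤a)))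

  implied⇒gcd∣ : ∀ q c → 0 ℕ.< q → ImpliedMod q M c → ∀ i (i<r : toℕ i ℕ.< r) → + gcd q (d (toℕ i)) ∣ U i · c
  implied⇒gcd∣ q c 0<q implied i i<r = [∣y*d⇒∣y*u]⇒gcd∣u q (d (toℕ i)) (U i · c) 0<q λ y q∣yd →
      subst (_ ∣_) (trans (Σ-cong (λ l → ℤP.*-assoc y (U i l) (c l))) (Σ-*ˡ y (λ l → U i l * c l)))
        (implied (λ l → y * U i l) (λ a → subst (_ ∣_) (sym (yUᵢM y a)) (∣-⊙ _ V' (q∣y*basis⊙D y q∣yd) a)))
    where
    yUᵢM : ∀ y a → ((λ l → y * U i l) ⊙ M) a ≡ ((λ b → y * (basis i ⊙ D) b) ⊙ V') a
    yUᵢM y a = begin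
      ((λ l → y * U i l) ⊙ M) a           ≡⟨ ⊙-* y (U i) M a ⟩
      y * (U i ⊙ M) a                     ≡⟨ cong (y *_) (sym (⊙-inverse (U i ⊙ M) V V' VV' a)) ⟩
      y * (((U i ⊙ M) ⊙ V) ⊙ V') a        ≡⟨ sym (⊙-* y ((U i ⊙ M) ⊙ V) V' a) ⟩
      ((λ b → y * ((U i ⊙ M) ⊙ V) b) ⊙ V') a  ≡⟨ ⊙-congˡ V' (λ b → cong (y *_) (UᵢMV b)) a ⟩
      ((λ b → y * (basis i ⊙ D) b) ⊙ V') a    ∎
      where open ≡-Reasoning
            UᵢMV : ∀ b → ((U i ⊙ M) ⊙ V) b ≡ (basis i ⊙ D) b
            UᵢMV b = trans (⊙-congˡ V (⊙-congˡ M (λ l → sym (⊙-basis i U l))) b) (⊙UMV (basis i) b)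

    q∣y*basis⊙D : ∀ y → + q ∣ y * + d (toℕ i) → ∀ b → + q ∣ y * (basis i ⊙ D) b
    q∣y*basis⊙D y q∣yd b with toℕ b ℕ.<? r
    ... | no  b≮r = subst (_ ∣_) (sym (trans (cong (y *_) (⊙D-beyond (basis i) b (ℕP.≮⇒≥ b≮r))) (ℤP.*-zeroʳ y))) ∣0ℤ
    ... | yes b<r with rowAt b b<r Fin.≟ i
    ...   | yes refl = subst (_ ∣_) (sym (cong (y *_) (trans (⊙D-below (basis i) b b<r)
                         (trans (cong (_* + d (toℕ b)) (basis-self i))
                           (trans (ℤP.*-identityˡ _) (cong (λ t → + d t) (sym (FinP.toℕ-fromℕ< _)))))))) q∣yd
    ...   | no  b≢i  = subst (_ ∣_) (sym (trans (cong (y *_) (trans (⊙D-below (basis i) b b<r)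
                         (cong (_* + d (toℕ b)) (basis-other i _ b≢i)))) (ℤP.*-zeroʳ y))) ∣0ℤ

  gcd∣⇒implied : ∀ q c → (∀ i → r ℕ.≤ toℕ i → U i · c ≡ 0ℤ) →
                 (∀ i (i<r : toℕ i ℕ.< r) → + gcd q (d (toℕ i)) ∣ U i · c) → ImpliedMod q M c
  gcd∣⇒implied q c u-beyond gcd∣u w q∣wM = subst (_ ∣_) y·u≡w·c (∣-Σ (λ i → y i * U i · c) q∣yᵢuᵢ)
    where
    y : ℤ^ p
    y = w ⊙ U'

    y·u≡w·c : y · (λ i → U i · c) ≡ w · c
    y·u≡w·c = trans (sym (⊙-· y U c)) (Σ-cong (λ l → cong (_* c l) (⊙-inverse w U' U U'U l)))

    q∣yᵢuᵢ : ∀ i → + q ∣ y i * U i · c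
    q∣yᵢuᵢ i with toℕ i ℕ.<? r
    ... | no  i≮r = subst (_ ∣_) (sym (trans (cong (y i *_) (u-beyond i (ℕP.≮⇒≥ i≮r))) (ℤP.*-zeroʳ (y i)))) ∣0ℤ
    ... | yes i<r = gcd∣u⇒∣y*u q (d (toℕ i)) (U i · c) (gcd∣u i i<r) (y i)
          (subst (_ ∣_) (trans (⊙MV w a) (⊙D-on y i a (sym (FinP.toℕ-fromℕ< _)) (subst (ℕ._< r) (sym (FinP.toℕ-fromℕ< _)) i<r)))
                 (∣-⊙ (w ⊙ M) V q∣wM a))
      where a = colAt i i<r

-- Rank of a matrix with one more column

-- The hypotheses say that N has the columns of M together with c, up to order and repetition.
module AdjoinedColumn
  {p k k′} {M : Mat p k} {N : Mat p k′} {r e r′ e′ : ℕ} (SM : SNF M r e) (SN : SNF N r′ e′) (c : ℤ^ p)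
  (null⇒ : ∀ y → LeftNull y N → LeftNull y M × y · c ≡ 0ℤ)
  (null⇐ : ∀ y → LeftNull y M → y · c ≡ 0ℤ → LeftNull y N)
  where
  private
    module SM = SmithForm SM
    module SN = SmithForm SN

  rank≤ : r′ ℕ.≤ suc r
  rank≤ = independent⇒≤ (SN.leadingRows ⊗ P) λ l lP≡0 →
      SN.leadingRows-independent l (λ a → trans (sym (⊙-assoc l SN.leadingRows N a))
        (null⇐ (l ⊙ SN.leadingRows) (yM≡0 l lP≡0) (trans (⊙-assoc l SN.leadingRows P Fin.zero) (lP≡0 Fin.zero)) a))
    where
    P : Mat p (suc r)
    P i Fin.zero    = c i
    P i (Fin.suc b) = (M ⊗ SM.V) i (SM.embedₖ b)

    yM≡0 : ∀ l → LeftNull l (SN.leadingRows ⊗ P) → LeftNull (l ⊙ SN.leadingRows) M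
    yM≡0 l lP≡0 = SM.⊙M≡0-from-leading (l ⊙ SN.leadingRows) λ b b<r → begin
      (((l ⊙ SN.leadingRows) ⊙ M) ⊙ SM.V) b                  ≡⟨ ⊙-assoc (l ⊙ SN.leadingRows) M SM.V b ⟩
      ((l ⊙ SN.leadingRows) ⊙ (M ⊗ SM.V)) b                  ≡⟨ cong ((l ⊙ SN.leadingRows) ⊙ (M ⊗ SM.V)) (sym (SM.embedₖ-fromℕ< b b<r)) ⟩
      ((l ⊙ SN.leadingRows) ⊙ P) (Fin.suc (fromℕ< b<r))      ≡⟨ ⊙-assoc l SN.leadingRows P (Fin.suc (fromℕ< b<r)) ⟩
      (l ⊙ (SN.leadingRows ⊗ P)) (Fin.suc (fromℕ< b<r))      ≡⟨ lP≡0 (Fin.suc (fromℕ< b<r)) ⟩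
      0ℤ                                                     ∎
      where open ≡-Reasoning

  rank≥ : ∀ i₀ → r ℕ.≤ toℕ i₀ → SM.U i₀ · c ≢ 0ℤ → suc r ℕ.≤ r′
  rank≥ i₀ r≤i₀ uᵢ₀≢0 = SN.independent⇒≤rank Y λ l lYN≡0 → lY≡0 l (null⇒ (l ⊙ Y) (λ a → trans (⊙-assoc l Y N a) (lYN≡0 a)))
    where
    Y : Mat (suc r) p
    Y Fin.zero    = SM.U i₀
    Y (Fin.suc t) = SM.leadingRows t

    lY≡0 : ∀ l → LeftNull (l ⊙ Y) M × (l ⊙ Y) · c ≡ 0ℤ → ∀ t → l t ≡ 0ℤ
    lY≡0 l (lYM≡0 , lY·c≡0) = λ { Fin.zero → l₀≡0 ; (Fin.suc t) → l′≡0 t }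
      where
      l′ : ℤ^ r
      l′ = l ∘ Fin.suc

      l′≡0 : ∀ t → l′ t ≡ 0ℤ
      l′≡0 = SM.leadingRows-independent l′ λ a → trans (sym (⊙-assoc l′ SM.leadingRows M a)) (begin
        ((l′ ⊙ SM.leadingRows) ⊙ M) a                                ≡⟨ sym (ℤP.+-identityˡ _) ⟩
        0ℤ + ((l′ ⊙ SM.leadingRows) ⊙ M) a                           ≡⟨ cong (_+ ((l′ ⊙ SM.leadingRows) ⊙ M) a)
                                                                           (sym (trans (⊙-* (l Fin.zero) (SM.U i₀) M a)
                                                                             (trans (cong (l Fin.zero *_) (SM.U-beyond-rank i₀ r≤i₀ a))
                                                                                    (ℤP.*-zeroʳ (l Fin.zero))))) ⟩
        ((λ i → l Fin.zero * SM.U i₀ i) ⊙ M) a + ((l′ ⊙ SM.leadingRows) ⊙ M) a  ≡⟨ sym (⊙-+ (λ i → l Fin.zero * SM.U i₀ i) (l′ ⊙ SM.leadingRows) M a) ⟩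
        ((l ⊙ Y) ⊙ M) a                                              ≡⟨ lYM≡0 a ⟩
        0ℤ                                                           ∎)
        where open ≡-Reasoning

      l₀≡0 : l Fin.zero ≡ 0ℤ
      l₀≡0 = i*j≡0∧j≢0⇒i≡0 (SM.U i₀ · c) uᵢ₀≢0 (begin
        l Fin.zero * SM.U i₀ · c                     ≡⟨ sym (⊙-* (l Fin.zero) (SM.U i₀) column Fin.zero) ⟩
        ((λ i → l Fin.zero * SM.U i₀ i) ⊙ column) Fin.zero ≡⟨ ⊙-congˡ column (λ i → sym (lYᵢ i)) Fin.zero ⟩
        (l ⊙ Y) · c                                  ≡⟨ lY·c≡0 ⟩
        0ℤ                                           ∎)
        where
        open ≡-Reasoning
        column : Mat p 1
        column i _ = c i
        lYᵢ : ∀ i → (l ⊙ Y) i ≡ l Fin.zero * SM.U i₀ i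
        lYᵢ i = trans (cong (_+_ (l Fin.zero * SM.U i₀ i)) (Σ-zero (λ t → cong (_* SM.leadingRows t i) (l′≡0 t))))
                      (ℤP.+-identityʳ _)

  rank≡suc : ∀ i₀ → r ℕ.≤ toℕ i₀ → SM.U i₀ · c ≢ 0ℤ → r′ ≡ suc r
  rank≡suc i₀ r≤i₀ uᵢ₀≢0 = ℕP.≤-antisym rank≤ (rank≥ i₀ r≤i₀ uᵢ₀≢0)

_ᵀ : ∀ {p k} → Mat p k → Mat k p
(M ᵀ) i j = M j i

⊗-ᵀ : ∀ {p k l} (A : Mat k p) (B : Mat l k) i j → ((A ᵀ) ⊗ (B ᵀ)) i j ≡ (B ⊗ A) j i
⊗-ᵀ A B i j = Σ-cong (λ t → ℤP.*-comm (A t i) (B j t))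

diagMat-ᵀ : ∀ {p k} r d (i : Fin p) (j : Fin k) → diagMat {p} {k} r d i j ≡ diagMat {k} {p} r d j i
diagMat-ᵀ r d i j with toℕ i ℕ.≟ toℕ j
... | yes i≡j rewrite i≡j = refl
... | no  i≢j with toℕ i ℕ.≡ᵇ toℕ j in e₁ | toℕ j ℕ.≡ᵇ toℕ i in e₂
...   | true  | _     = ⊥-elim (i≢j (ℕP.≡ᵇ⇒≡ _ _ (subst T (sym e₁) tt)))
...   | false | true  = ⊥-elim (i≢j (sym (ℕP.≡ᵇ⇒≡ _ _ (subst T (sym e₂) tt))))
...   | false | false = refl

SNF-ᵀ : ∀ {p k} {M : Mat p k} {r e} → SNF M r e → SNF (M ᵀ) r e
SNF-ᵀ {M = M} {r} S = record
  { U = V ᵀ ; U' = V' ᵀ ; V = U ᵀ ; V' = U' ᵀ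
  ; UU' = λ i j → trans (⊗-ᵀ V V' i j) (trans (V'V j i) (idMat-sym j i))
  ; U'U = λ i j → trans (⊗-ᵀ V' V i j) (trans (VV' j i) (idMat-sym j i))
  ; VV' = λ i j → trans (⊗-ᵀ U U' i j) (trans (U'U j i) (idMat-sym j i))
  ; V'V = λ i j → trans (⊗-ᵀ U' U i j) (trans (UU' j i) (idMat-sym j i))
  ; d = d ; r≤p = r≤k ; r≤k = r≤p ; dpos = dpos ; ddiv = ddiv
  ; diag = λ i j → trans (Σ-cong (λ t → trans (cong (_* U j t) (⊗-ᵀ V M i t)) (ℤP.*-comm _ (U j t))))
                        (trans (sym (⊙-assoc (U j) M V i)) (trans (diag j i) (diagMat-ᵀ r d j i)))
  ; last = last }
  where open SNF S

Σ-split : ∀ p (f : Fin (p ℕ.+ 1) → ℤ) → Σℤ f ≡ Σℤ (λ i → f (i ↑ˡ 1)) + f (p ↑ʳ Fin.zero)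
Σ-split zero    f = trans (ℤP.+-identityʳ (f Fin.zero)) (sym (ℤP.+-identityˡ (f Fin.zero)))
Σ-split (suc p) f = trans (cong (_+_ (f Fin.zero)) (Σ-split p (f ∘ Fin.suc))) (sym (ℤP.+-assoc (f Fin.zero) _ _))

top-or-bottom : ∀ p (l : Fin (p ℕ.+ 1)) → (∃ λ i → l ≡ i ↑ˡ 1) ⊎ l ≡ p ↑ʳ Fin.zero
top-or-bottom zero    Fin.zero    = inj₂ refl
top-or-bottom (suc p) Fin.zero    = inj₁ (Fin.zero , refl)
top-or-bottom (suc p) (Fin.suc l) with top-or-bottom p l
... | inj₁ (i , refl) = inj₁ (Fin.suc i , refl)
... | inj₂ refl       = inj₂ refl

appendRow : ∀ {p k} → Mat p k → ℤ^ k → Mat (p ℕ.+ 1) k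
appendRow {p} M b l a = [ (λ i → M i a) , (λ _ → b a) ] (splitAt p l)

appendRow-top : ∀ {p k} (M : Mat p k) b i a → appendRow M b (i ↑ˡ 1) a ≡ M i a
appendRow-top {p} M b i a = cong [ (λ i → M i a) , (λ _ → b a) ] (FinP.splitAt-↑ˡ p i 1)

appendRow-bottom : ∀ {p k} (M : Mat p k) b a → appendRow M b (p ↑ʳ Fin.zero) a ≡ b a
appendRow-bottom {p} M b a = cong [ (λ i → M i a) , (λ _ → b a) ] (FinP.splitAt-↑ʳ p 1 Fin.zero)

⊙-appendRow : ∀ {p k} (M : Mat p k) b (x : ℤ^ (p ℕ.+ 1)) a →
              (x ⊙ appendRow M b) a ≡ ((λ i → x (i ↑ˡ 1)) ⊙ M) a + x (p ↑ʳ Fin.zero) * b a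
⊙-appendRow {p} M b x a = trans (Σ-split p (λ l → x l * appendRow M b l a))
  (cong₂ _+_ (Σ-cong (λ i → cong (x (i ↑ˡ 1) *_) (appendRow-top M b i a))) (cong (x (p ↑ʳ Fin.zero) *_) (appendRow-bottom M b a)))

null-appendRowᵀ⇒ : ∀ {p k} (M : Mat p k) b (y : ℤ^ k) → LeftNull y (appendRow M b ᵀ) → LeftNull y (M ᵀ) × y · b ≡ 0ℤ
null-appendRowᵀ⇒ {p} M b y yAᵀ≡0 =
    (λ i → trans (Σ-cong (λ a → cong (y a *_) (sym (appendRow-top M b i a)))) (yAᵀ≡0 (i ↑ˡ 1)))
  , trans (Σ-cong (λ a → cong (y a *_) (sym (appendRow-bottom M b a)))) (yAᵀ≡0 (p ↑ʳ Fin.zero))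

null-appendRowᵀ⇐ : ∀ {p k} (M : Mat p k) b (y : ℤ^ k) → LeftNull y (M ᵀ) → y · b ≡ 0ℤ → LeftNull y (appendRow M b ᵀ)
null-appendRowᵀ⇐ {p} M b y yMᵀ≡0 y·b≡0 l with top-or-bottom p l
... | inj₁ (i , refl) = trans (Σ-cong (λ a → cong (y a *_) (appendRow-top M b i a))) (yMᵀ≡0 i)
... | inj₂ refl       = trans (Σ-cong (λ a → cong (y a *_) (appendRow-bottom M b a))) y·b≡0

module AppendedRow {p k} {M : Mat p k} {b : ℤ^ k} {r e r′ e′ : ℕ} (SM : SNF M r e) (SA : SNF (appendRow M b) r′ e′) where
  open SmithForm SM

  rank≡suc : ∀ a₀ → r ℕ.≤ toℕ a₀ → (b ⊙ V) a₀ ≢ 0ℤ → r′ ≡ suc r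
  rank≡suc a₀ r≤a₀ β≢0 =
    AdjoinedColumn.rank≡suc (SNF-ᵀ SM) (SNF-ᵀ SA) b (null-appendRowᵀ⇒ M b) (null-appendRowᵀ⇐ M b) a₀ r≤a₀
      (λ eq → β≢0 (trans (Σ-cong (λ l → ℤP.*-comm (b l) (V l a₀))) eq))

  module _ (q : ℕ) (z : ℤ^ p) (Q : ℤ^ k) (zM≡Qq+b : ∀ a → (z ⊙ M) a ≡ Q a * + q + b a) where

    q[-Q]∈RowLattice : (λ a → + q * - Q a) ∈RowLattice appendRow M b
    q[-Q]∈RowLattice = x , λ a → sym (begin
      (x ⊙ appendRow M b) a                             ≡⟨ ⊙-appendRow M b x a ⟩
      ((λ i → x (i ↑ˡ 1)) ⊙ M) a + x (p ↑ʳ Fin.zero) * b a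
        ≡⟨ cong₂ (λ u v → u + v * b a)
                 (⊙-congˡ M (λ i → trans (appendRow-top {k = 1} (λ i _ → - z i) (λ _ → 1ℤ) i Fin.zero) (sym (ℤP.-1*i≡-i (z i)))) a)
                 (appendRow-bottom {k = 1} (λ i _ → - z i) (λ _ → 1ℤ) Fin.zero) ⟩
      ((λ i → - 1ℤ * z i) ⊙ M) a + 1ℤ * b a             ≡⟨ cong (λ u → u + 1ℤ * b a) (⊙-* (- 1ℤ) z M a) ⟩
      - 1ℤ * (z ⊙ M) a + 1ℤ * b a                       ≡⟨ cong (λ u → - 1ℤ * u + 1ℤ * b a) (zM≡Qq+b a) ⟩
      - 1ℤ * (Q a * + q + b a) + 1ℤ * b a               ≡⟨ simplify (Q a) (+ q) (b a) ⟩
      + q * - Q a                                       ∎)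
      where
      open ≡-Reasoning
      x : ℤ^ (p ℕ.+ 1)
      x l = appendRow {k = 1} (λ i _ → - z i) (λ _ → 1ℤ) l Fin.zero
      simplify : ∀ Q q B → - 1ℤ * (Q * q + B) + 1ℤ * B ≡ q * - Q
      simplify = solve-∀

    eliminate-Q : ∀ c → (λ a → c * - Q a) ∈RowLattice appendRow M b → ∃ λ t → (λ a → (c - + q * t) * b a) ∈RowLattice M
    eliminate-Q c (x′ , c[-Q]≡x′A) = t , (λ i → c * z i + + q * x′ₜ i) , λ a → sym (begin
      ((λ i → c * z i + + q * x′ₜ i) ⊙ M) a                    ≡⟨ ⊙-+ (λ i → c * z i) (λ i → + q * x′ₜ i) M a ⟩
      ((λ i → c * z i) ⊙ M) a + ((λ i → + q * x′ₜ i) ⊙ M) a    ≡⟨ cong₂ _+_ (⊙-* c z M a) (⊙-* (+ q) x′ₜ M a) ⟩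
      c * (z ⊙ M) a + + q * (x′ₜ ⊙ M) a                        ≡⟨ cong₂ (λ u v → c * u + + q * v) (zM≡Qq+b a) (x′ₜM a) ⟩
      c * (Q a * + q + b a) + + q * (c * - Q a - t * b a)      ≡⟨ simplify c (Q a) (+ q) (b a) t ⟩
      (c - + q * t) * b a                                      ∎)
      where
      open ≡-Reasoning
      x′ₜ : ℤ^ p
      x′ₜ i = x′ (i ↑ˡ 1)
      t = x′ (p ↑ʳ Fin.zero)
      x′ₜM : ∀ a → (x′ₜ ⊙ M) a ≡ c * - Q a - t * b a
      x′ₜM a = trans (undo ((x′ₜ ⊙ M) a) (t * b a)) (cong (_- t * b a) (sym (trans (c[-Q]≡x′A a) (⊙-appendRow M b x′ a))))
        where undo : ∀ X Y → X ≡ (X + Y) - Y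
              undo = solve-∀
      simplify : ∀ E Q q B T → E * (Q * q + B) + q * (E * - Q - T * B) ≡ (E - q * T) * B
      simplify = solve-∀

  -- q (-Q) = (-z, 1) A for z M - b = q Q; clearing torsion replaces q by e′, and eliminating Q
  -- leaves (e′ - q t) b in the row lattice of M, which forces e′ = q t since b V has a nonzero entry beyond r.
  solvable⇒∣lastFactor : ∀ q → 0 ℕ.< q → SolvableMod q M b → ∀ a₀ → r ℕ.≤ toℕ a₀ → (b ⊙ V) a₀ ≢ 0ℤ → + q ∣ + e′
  solvable⇒∣lastFactor q 0<q (z , q∣zM-b) a₀ r≤a₀ β≢0 = divides t (trans e′≡qt (ℤP.*-comm (+ q) t))
    where
    Q : ℤ^ k
    Q a = ℤD.quotient (q∣zM-b a)

    zM≡Qq+b : ∀ a → (z ⊙ M) a ≡ Q a * + q + b a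
    zM≡Qq+b a = trans (undo ((z ⊙ M) a) (b a)) (cong (_+ b a) (ℤD._∣_.equality (q∣zM-b a)))
      where undo : ∀ Z B → Z ≡ (Z - B) + B
            undo = solve-∀

    q≢0 : + q ≢ 0ℤ
    q≢0 q≡0 = ℕP.<⇒≢ 0<q (sym (ℤP.+-injective q≡0))

    eliminated = eliminate-Q q z Q zM≡Qq+b (+ e′)
                   (SmithForm.lastFactor-kills-torsion SA (+ q) (-_ ∘ Q) q≢0 (q[-Q]∈RowLattice q z Q zM≡Qq+b))
    t = proj₁ eliminated

    e′≡qt : + e′ ≡ + q * t
    e′≡qt = ℤP.i-j≡0⇒i≡j (+ e′) (+ q * t)
              (i*j≡0∧j≢0⇒i≡0 ((b ⊙ V) a₀) β≢0 (∈RowLattice⇒beyond-rank (+ e′ - + q * t) b (proj₂ eliminated) a₀ r≤a₀))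

elems-sound : ∀ {n} (J : Subset n) {x} → x ∈ₗ elems J → x ∈ J
elems-sound (inside  ∷ J) (here refl) = Vec.here
elems-sound (inside  ∷ J) (there x∈) with ∈ₗ.∈-map⁻ Fin.suc x∈
... | _ , x′∈ , refl = Vec.there (elems-sound J x′∈)
elems-sound (outside ∷ J) x∈ with ∈ₗ.∈-map⁻ Fin.suc x∈
... | _ , x′∈ , refl = Vec.there (elems-sound J x′∈)

elems-complete : ∀ {n} (J : Subset n) {x} → x ∈ J → x ∈ₗ elems J
elems-complete (inside  ∷ J) Vec.here       = here refl
elems-complete (inside  ∷ J) (Vec.there x∈) = there (∈ₗ.∈-map⁺ Fin.suc (elems-complete J x∈))
elems-complete (outside ∷ J) (Vec.there x∈) = ∈ₗ.∈-map⁺ Fin.suc (elems-complete J x∈)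

lookup-elems∈ : ∀ {n} (J : Subset n) a → lookup (elems J) a ∈ J
lookup-elems∈ J a = elems-sound J (∈ₗ.∈-lookup a)

∈⇒lookup-elems : ∀ {n} (J : Subset n) {x} → x ∈ J → ∃ λ a → lookup (elems J) a ≡ x
∈⇒lookup-elems J x∈ = Any.index x∈ₗ , sym (AnyP.lookup-index x∈ₗ)
  where x∈ₗ = elems-complete J x∈

∈-allSubsets : ∀ {n} (J : Subset n) → J ∈ₗ allSubsets n
∈-allSubsets []            = here refl
∈-allSubsets (inside  ∷ J) = ∈ₗ.∈-++⁺ˡ (∈ₗ.∈-map⁺ (inside ∷_) (∈-allSubsets J))
∈-allSubsets {suc n} (outside ∷ J) = ∈ₗ.∈-++⁺ʳ (map (inside ∷_) (allSubsets n)) (∈ₗ.∈-map⁺ (outside ∷_) (∈-allSubsets J))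

∈-nonemptySubsets : ∀ {n} (J : Subset n) → Nonempty J → J ∈ₗ nonemptySubsets n
∈-nonemptySubsets J ne = ∈ₗ.∈-filter⁺ nonempty? (∈-allSubsets J) ne

≤maxℕ : ∀ {x} xs → x ∈ₗ xs → x ℕ.≤ maxℕ xs
≤maxℕ (y ∷ xs) (here refl) = ℕP.m≤m⊔n y (maxℕ xs)
≤maxℕ (y ∷ xs) (there x∈)  = ℕP.≤-trans (≤maxℕ xs x∈) (ℕP.m≤n⊔m y (maxℕ xs))

∣lcmList : ∀ {x} xs → x ∈ₗ xs → x ℕD.∣ lcmList xs
∣lcmList (y ∷ xs) (here refl) = m∣lcm[m,n] y (lcmList xs)
∣lcmList (y ∷ xs) (there x∈)  = ℕD.∣-trans (∣lcmList xs x∈) (n∣lcm[m,n] y (lcmList xs))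

∣gcdList : ∀ {d} xs → (∀ {x} → x ∈ₗ xs → d ℕD.∣ x) → d ℕD.∣ foldr gcd 0 xs
∣gcdList []       _   = ℕD.divides 0 refl
∣gcdList (x ∷ xs) d∣x = gcd-greatest (d∣x (here refl)) (∣gcdList xs (d∣x ∘ there))

gcdList∣ : ∀ {x} xs → x ∈ₗ xs → foldr gcd 0 xs ℕD.∣ x
gcdList∣ (y ∷ xs) (here refl) = gcd[m,n]∣m y _
gcdList∣ (y ∷ xs) (there x∈)  = ℕD.∣-trans (gcd[m,n]∣n y _) (gcdList∣ xs x∈)

module _ (q : ℕ) .{{_ : ℕ.NonZero q}} where
  open import Data.Integer.DivMod using (_%ℕ_; _/ℕ_; n%ℕd<d; a≡a%ℕn+[a/ℕn]*n)

  reduce : ∀ {m} → ℤ^ m → Vecq q m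
  reduce z i = fromℕ< (n%ℕd<d (z i) q)

  reduce≡ : ∀ {m} (z : ℤ^ m) i → + q ∣ + toℕ (reduce z i) - z i
  reduce≡ z i = divides (- (z i /ℕ q)) (trans (cong (λ t → + t - z i) (FinP.toℕ-fromℕ< _))
     (trans (cong (_-_ (+ (z i %ℕ q))) (a≡a%ℕn+[a/ℕn]*n (z i) q)) (cancel (+ (z i %ℕ q)) (z i /ℕ q) (+ q))))
    where cancel : ∀ R T Q → R - (R + T * Q) ≡ (- T) * Q
          cancel = solve-∀

  ≡reduce : ∀ {m} (z : ℤ^ m) i → + q ∣ z i - + toℕ (reduce z i)
  ≡reduce z i = subst (_ ∣_) (flip (+ toℕ (reduce z i)) (z i)) (ℤD.∣m⇒∣-m (reduce≡ z i))
    where flip : ∀ X Y → - (X - Y) ≡ Y - X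
          flip = solve-∀

-- The sets H_{J,q}, read over ℤ

module Arrangement {m n : ℕ} (C : Mat m n) (b : ℤ^ n) where

  InHℤ : ℕ → Subset n → ℤ^ m → Set
  InHℤ q J z = ∀ j → j ∈ J → + q ∣ (z ⊙ C) j - b j

  InLℤ : ℕ → Subset n → Set
  InLℤ q J = ∃ (InHℤ q J)

  LeLℤ : ℕ → Subset n → Subset n → Set
  LeLℤ q J₁ J₂ = ∀ z → InHℤ q J₂ z → InHℤ q J₁ z

  ImpliedAt : ℕ → Subset n → Fin n → Set
  ImpliedAt q J j = ∀ w → (∀ l → l ∈ J → + q ∣ (w ⊙ C) l) → + q ∣ (w ⊙ C) j

  InHℤ-resp : ∀ q J (x y : ℤ^ m) → (∀ i → + q ∣ x i - y i) → InHℤ q J x → InHℤ q J y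
  InHℤ-resp q J x y q∣x-y x∈H j j∈J =
      subst (_ ∣_) (trans (cong (_-_ ((x ⊙ C) j - b j)) (⊙-- x y C j)) (cancel ((x ⊙ C) j) ((y ⊙ C) j) (b j)))
        (ℤD.∣m∣n⇒∣m-n (x∈H j j∈J) (∣-⊙ (λ i → x i - y i) C q∣x-y j))
    where cancel : ∀ X Y B → (X - B) - (X - Y) ≡ Y - B
          cancel = solve-∀

  representative : ∀ {q} → Vecq q m → ℤ^ m
  representative z i = + toℕ (z i)

  InL⇒InLℤ : ∀ q J → InL q C b J → InLℤ q J
  InL⇒InLℤ q J (z , z∈H) = representative z , λ j j∈J → ℤD.∣ᵤ⇒∣ (z∈H j j∈J)

  InH-reduce : ∀ q .{{_ : ℕ.NonZero q}} J z → InHℤ q J z → InH q C b J (reduce q z)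
  InH-reduce q J z z∈H j j∈J = ℤD.∣⇒∣ᵤ (InHℤ-resp q J z (representative (reduce q z)) (≡reduce q z) z∈H j j∈J)

  InLℤ⇒InL : ∀ q → 0 ℕ.< q → ∀ J → InLℤ q J → InL q C b J
  InLℤ⇒InL q 0<q J (z , z∈H) = reduce q z , InH-reduce q J z z∈H
    where instance _ = ℕ.>-nonZero 0<q

  LeL⇒LeLℤ : ∀ q → 0 ℕ.< q → ∀ J₁ J₂ → LeL q C b J₁ J₂ → LeLℤ q J₁ J₂
  LeL⇒LeLℤ q 0<q J₁ J₂ H₂⊆H₁ z z∈H₂ = InHℤ-resp q J₁ (representative (reduce q z)) z (reduce≡ q z)
      (λ j j∈J₁ → ℤD.∣ᵤ⇒∣ (H₂⊆H₁ (reduce q z) (InH-reduce q J₂ z z∈H₂) j j∈J₁))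
    where instance _ = ℕ.>-nonZero 0<q

  LeLℤ⇒LeL : ∀ q J₁ J₂ → LeLℤ q J₁ J₂ → LeL q C b J₁ J₂
  LeLℤ⇒LeL q J₁ J₂ H₂⊆H₁ z z∈H₂ j j∈J₁ =
    ℤD.∣⇒∣ᵤ (H₂⊆H₁ (representative z) (λ l l∈J₂ → ℤD.∣ᵤ⇒∣ (z∈H₂ l l∈J₂)) j j∈J₁)

  bOn : (J : Subset n) → ℤ^ List.length (elems J)
  bOn J a = b (lookup (elems J) a)

  column : Fin n → ℤ^ m
  column j i = C i j

  InLℤ⇒solvable : ∀ q J → InLℤ q J → SolvableMod q (subMat C J) (bOn J)
  InLℤ⇒solvable q J (z , z∈H) = z , λ a → z∈H _ (lookup-elems∈ J a)

  solvable⇒InLℤ : ∀ q J → SolvableMod q (subMat C J) (bOn J) → InLℤ q J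
  solvable⇒InLℤ q J (z , solves) = z , λ j j∈J →
    let a , aⱼ≡j = ∈⇒lookup-elems J j∈J in subst (λ l → + q ∣ (z ⊙ C) l - b l) aⱼ≡j (solves a)

  ImpliedAt⇒ImpliedMod : ∀ q J j → ImpliedAt q J j → ImpliedMod q (subMat C J) (column j)
  ImpliedAt⇒ImpliedMod q J j implied w q∣wM = implied w λ l l∈J →
    let a , aₗ≡l = ∈⇒lookup-elems J l∈J in subst (λ l → + q ∣ (w ⊙ C) l) aₗ≡l (q∣wM a)

  ImpliedMod⇒ImpliedAt : ∀ q J j → ImpliedMod q (subMat C J) (column j) → ImpliedAt q J j
  ImpliedMod⇒ImpliedAt q J j implied w q∣wC = implied w (λ a → q∣wC _ (lookup-elems∈ J a))

  null-subMat⇒ : ∀ J y → LeftNull y (subMat C J) → ∀ l → l ∈ J → (y ⊙ C) l ≡ 0ℤ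
  null-subMat⇒ J y yM≡0 l l∈J = let a , aₗ≡l = ∈⇒lookup-elems J l∈J in trans (cong (y ⊙ C) (sym aₗ≡l)) (yM≡0 a)

  null-subMat⇐ : ∀ J y → (∀ l → l ∈ J → (y ⊙ C) l ≡ 0ℤ) → LeftNull y (subMat C J)
  null-subMat⇐ J y yC≡0 a = yC≡0 _ (lookup-elems∈ J a)

  rank-∪ : ∀ J j {r e r′ e′} (S : SNF (subMat C J) r e) → SNF (subMat C (J ∪ ⁅ j ⁆)) r′ e′ →
           ∀ i₀ → r ℕ.≤ toℕ i₀ → SNF.U S i₀ · column j ≢ 0ℤ → r′ ≡ suc r
  rank-∪ J j S S′ = AdjoinedColumn.rank≡suc S S′ (column j) null⇒ null⇐
    where
    J′ = J ∪ ⁅ j ⁆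
    null⇒ : ∀ y → LeftNull y (subMat C J′) → LeftNull y (subMat C J) × y · column j ≡ 0ℤ
    null⇒ y yM′≡0 = null-subMat⇐ J y (λ l l∈J → null-subMat⇒ J′ y yM′≡0 l (x∈p∪q⁺ (inj₁ l∈J)))
                  , null-subMat⇒ J′ y yM′≡0 j (x∈p∪q⁺ (inj₂ (x∈⁅x⁆ j)))
    null⇐ : ∀ y → LeftNull y (subMat C J) → y · column j ≡ 0ℤ → LeftNull y (subMat C J′)
    null⇐ y yM≡0 ycⱼ≡0 = null-subMat⇐ J′ y λ l l∈J′ →
      [ null-subMat⇒ J y yM≡0 l , (λ l∈j → subst (λ l → (y ⊙ C) l ≡ 0ℤ) (sym (x∈⁅y⁆⇒x≡y j l∈j)) ycⱼ≡0) ] (x∈p∪q⁻ J ⁅ j ⁆ l∈J′)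

  indicator : (J : Subset n) → Fin n → ℤ^ List.length (elems J)
  indicator J j a with lookup (elems J) a Fin.≟ j
  ... | yes _ = 1ℤ
  ... | no  _ = 0ℤ

  indicator-at : ∀ J j a → lookup (elems J) a ≡ j → indicator J j a ≡ 1ℤ
  indicator-at J j a aⱼ≡j with lookup (elems J) a Fin.≟ j
  ... | yes _    = refl
  ... | no  aⱼ≢j = ⊥-elim (aⱼ≢j aⱼ≡j)

  indicator-off : ∀ J j a → lookup (elems J) a ≢ j → indicator J j a ≡ 0ℤ
  indicator-off J j a aⱼ≢j with lookup (elems J) a Fin.≟ j
  ... | yes aⱼ≡j = ⊥-elim (aⱼ≢j aⱼ≡j)
  ... | no  _    = refl

  -- z₀ C_{J ∪ {j}} = (z₀ c_j) 𝟙_j; clearing its torsion yields x with x c_l = 0 for l ∈ J and x c_j = e′.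
  implied⇒∣lastFactor : ∀ q J j {r′ e′} → SNF (subMat C (J ∪ ⁅ j ⁆)) r′ e′ → ImpliedAt q J j →
                        ∀ (z₀ : ℤ^ m) → (∀ l → l ∈ J → (z₀ ⊙ C) l ≡ 0ℤ) → (z₀ ⊙ C) j ≢ 0ℤ → + q ∣ + e′
  implied⇒∣lastFactor q J j {e′ = e′} S′ implied z₀ z₀C≡0 u≢0 =
    subst (+ q ∣_) x′cⱼ≡e′ (implied x′ λ l l∈J → subst (+ q ∣_) (sym (x′cₗ≡0 l l∈J)) ∣0ℤ)
    where
    J′ = J ∪ ⁅ j ⁆
    u = (z₀ ⊙ C) j

    u𝟙ⱼ≡z₀M′ : ∀ a → u * indicator J′ j a ≡ (z₀ ⊙ subMat C J′) a
    u𝟙ⱼ≡z₀M′ a with lookup (elems J′) a Fin.≟ j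
    ... | yes aⱼ≡j = trans (ℤP.*-identityʳ u) (cong (z₀ ⊙ C) (sym aⱼ≡j))
    ... | no  aⱼ≢j = trans (ℤP.*-zeroʳ u) (sym ([ z₀C≡0 _ , ⊥-elim ∘ aⱼ≢j ∘ x∈⁅y⁆⇒x≡y j ]′ (x∈p∪q⁻ J ⁅ j ⁆ (lookup-elems∈ J′ a))))

    cleared = SmithForm.lastFactor-kills-torsion S′ u (indicator J′ j) u≢0 (z₀ , u𝟙ⱼ≡z₀M′)
    x′ = proj₁ cleared

    x′cₗ≡0 : ∀ l → l ∈ J → (x′ ⊙ C) l ≡ 0ℤ
    x′cₗ≡0 l l∈J = let a , aₗ≡l = ∈⇒lookup-elems J′ (x∈p∪q⁺ {q = ⁅ j ⁆} (inj₁ l∈J)) in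
      trans (cong (x′ ⊙ C) (sym aₗ≡l))
        (trans (sym (proj₂ cleared a))
          (trans (cong (+ e′ *_) (indicator-off J′ j a (λ aₗ≡j → u≢0 (z₀C≡0 j (subst (_∈ J) (trans (sym aₗ≡l) aₗ≡j) l∈J)))))
                 (ℤP.*-zeroʳ (+ e′))))

    x′cⱼ≡e′ : (x′ ⊙ C) j ≡ + e′
    x′cⱼ≡e′ = let a , aⱼ≡j = ∈⇒lookup-elems J′ (x∈p∪q⁺ (inj₂ (x∈⁅x⁆ j))) in
      trans (cong (x′ ⊙ C) (sym aⱼ≡j))
            (trans (sym (proj₂ cleared a)) (trans (cong (+ e′ *_) (indicator-at J′ j a aⱼ≡j)) (ℤP.*-identityʳ _)))

  ≤⇒∪-nonempty : ∀ q J₁ J₂ → InLℤ q J₂ → LeLℤ q J₁ J₂ → ∀ j → j ∈ J₁ → InLℤ q (J₂ ∪ ⁅ j ⁆)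
  ≤⇒∪-nonempty q J₁ J₂ (z₀ , z₀∈H₂) H₂⊆H₁ j j∈J₁ = z₀ , λ l l∈J′ →
    [ z₀∈H₂ l , (λ l∈j → subst (λ l → + q ∣ (z₀ ⊙ C) l - b l) (sym (x∈⁅y⁆⇒x≡y j l∈j)) (H₂⊆H₁ z₀ z₀∈H₂ j j∈J₁)) ]′
      (x∈p∪q⁻ J₂ ⁅ j ⁆ l∈J′)

  -- z₀ and z₀ + w both lie in H_{J₂} ⊆ H_{J₁}, so both satisfy congruence j.
  ≤⇒implied : ∀ q J₁ J₂ → InLℤ q J₂ → LeLℤ q J₁ J₂ → ∀ j → j ∈ J₁ → ImpliedAt q J₂ j
  ≤⇒implied q J₁ J₂ (z₀ , z₀∈H₂) H₂⊆H₁ j j∈J₁ w q∣wC =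
      subst (_ ∣_) (trans (cong (λ t → t - b j - ((z₀ ⊙ C) j - b j)) (⊙-+ z₀ w C j)) (cancel ((z₀ ⊙ C) j) ((w ⊙ C) j) (b j)))
        (ℤD.∣m∣n⇒∣m-n (H₂⊆H₁ z₀+w z₀+w∈H₂ j j∈J₁) (H₂⊆H₁ z₀ z₀∈H₂ j j∈J₁))
    where
    z₀+w : ℤ^ m
    z₀+w i = z₀ i + w i

    z₀+w∈H₂ : InHℤ q J₂ z₀+w
    z₀+w∈H₂ l l∈J₂ = subst (_ ∣_) (trans (shift ((z₀ ⊙ C) l) ((w ⊙ C) l) (b l)) (cong (_- b l) (sym (⊙-+ z₀ w C l))))
                       (ℤD.∣m∣n⇒∣m+n (z₀∈H₂ l l∈J₂) (q∣wC l l∈J₂))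
      where shift : ∀ X W B → (X - B) + W ≡ (X + W) - B
            shift = solve-∀

    cancel : ∀ X W B → X + W - B - (X - B) ≡ W
    cancel = solve-∀

  implied⇒≤ : ∀ q J₁ J₂ → (∀ j → j ∈ J₁ → InLℤ q (J₂ ∪ ⁅ j ⁆) × ImpliedAt q J₂ j) → LeLℤ q J₁ J₂
  implied⇒≤ q J₁ J₂ implied z z∈H₂ j j∈J₁ =
      subst (_ ∣_) (trans (cong (_+ ((z₁ ⊙ C) j - b j)) (⊙-- z z₁ C j)) (telescope ((z ⊙ C) j) ((z₁ ⊙ C) j) (b j)))
        (ℤD.∣m∣n⇒∣m+n (proj₂ (implied j j∈J₁) (λ i → z i - z₁ i) q∣[z-z₁]C) (z₁∈H j (x∈p∪q⁺ (inj₂ (x∈⁅x⁆ j)))))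
    where
    z₁ = proj₁ (proj₁ (implied j j∈J₁))
    z₁∈H = proj₂ (proj₁ (implied j j∈J₁))

    q∣[z-z₁]C : ∀ l → l ∈ J₂ → + q ∣ ((λ i → z i - z₁ i) ⊙ C) l
    q∣[z-z₁]C l l∈J₂ = subst (_ ∣_) (trans (cancel ((z ⊙ C) l) ((z₁ ⊙ C) l) (b l)) (sym (⊙-- z z₁ C l)))
                         (ℤD.∣m∣n⇒∣m-n (z∈H₂ l l∈J₂) (z₁∈H l (x∈p∪q⁺ (inj₁ l∈J₂))))
      where cancel : ∀ X Y B → (X - B) - (Y - B) ≡ X - Y
            cancel = solve-∀

    telescope : ∀ X Y B → X - Y + (Y - B) ≡ X - B
    telescope = solve-∀

-- Transfer between moduli beyond q*

module Transfer {m n : ℕ} (C : Mat m n) (nonzero-columns : ∀ j → ¬ (∀ i → C i j ≡ + 0)) (b : ℤ^ n)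
  (rkC eC rkA eA : Subset n → ℕ)
  (SC : ∀ J → Nonempty J → SNF (subMat C J) (rkC J) (eC J))
  (SA : ∀ J → Nonempty J → SNF (augMat C b J) (rkA J) (eA J)) where

  open Arrangement C b

  q* : ℕ
  q* = qStar C rkC eC rkA eA

  ∤-below : ∀ {q x} → 0 ℕ.< x → x ℕ.≤ q* → q* ℕ.< q → ¬ (+ q ∣ + x)
  ∤-below {x = suc x} _ x≤q* q*<q q∣x = ℕP.<⇒≱ (ℕP.≤-<-trans x≤q* q*<q) (ℕD.∣⇒≤ (ℤD.∣⇒∣ᵤ q∣x))

  eA≤q* : ∀ J → Nonempty J → rkA J ≡ suc (rkC J) → eA J ℕ.≤ q*
  eA≤q* J ne rank = ℕP.≤-trans
    (≤maxℕ _ (∈ₗ.∈-map⁺ eA (∈ₗ.∈-filter⁺ (λ J → rkA J ℕ.≟ suc (rkC J)) (∈-nonemptySubsets J ne) rank)))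
    (ℕP.≤-trans (ℕP.m≤m⊔n (q₀ rkC rkA eA) (q₁ rkC eC)) (ℕP.m≤m⊔n _ _))

  eC∪≤q* : ∀ J → Nonempty J → ∀ j → rkC (J ∪ ⁅ j ⁆) ≡ suc (rkC J) → eC (J ∪ ⁅ j ⁆) ℕ.≤ q*
  eC∪≤q* J ne j rank = ℕP.≤-trans (≤maxℕ _ (∈ₗ.∈-concatMap⁺ candidates (Any.map (λ { refl → at-j }) (∈ₗ.∈-allFin j))))
                                  (ℕP.≤-trans (ℕP.m≤n⊔m (q₀ rkC rkA eA) (q₁ rkC eC)) (ℕP.m≤m⊔n _ _))
    where
    candidates : Fin n → List ℕ
    candidates j = map (λ J → eC (J ∪ ⁅ j ⁆)) (filter (λ J → rkC (J ∪ ⁅ j ⁆) ℕ.≟ suc (rkC J)) (nonemptySubsets n))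
    at-j : eC (J ∪ ⁅ j ⁆) ∈ₗ candidates j
    at-j = ∈ₗ.∈-map⁺ (λ J → eC (J ∪ ⁅ j ⁆)) (∈ₗ.∈-filter⁺ (λ J → rkC (J ∪ ⁅ j ⁆) ℕ.≟ suc (rkC J)) (∈-nonemptySubsets J ne) rank)

  colGcd≤q* : ∀ j → colGcd C j ℕ.≤ q*
  colGcd≤q* j = ℕP.≤-trans (≤maxℕ _ (∈ₗ.∈-map⁺ (colGcd C) (∈ₗ.∈-allFin j))) (ℕP.m≤n⊔m _ _)

  invariantFactor∣ρ₀ : ∀ J (ne : Nonempty J) t → t ℕ.< rkC J → SNF.d (SC J ne) t ℕD.∣ ρ₀ eC
  invariantFactor∣ρ₀ J ne t t<r = ℕD.∣-trans (SmithForm.d∣e (SC J ne) t t<r)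
                                             (∣lcmList (map eC (nonemptySubsets n)) (∈ₗ.∈-map⁺ eC (∈-nonemptySubsets J ne)))

  -- With J = ∅ the implication says q divides every entry of c_j, hence q ∣ gcd c_j ≤ q*.
  ¬implied-by-∅ : ∀ {q} → q* ℕ.< q → ∀ J j → ¬ Nonempty J → ¬ ImpliedAt q J j
  ¬implied-by-∅ {q} q*<q J j empty implied = nonzero-columns j λ i →
      ℤP.∣i∣≡0⇒i≡0 (ℕD.0∣⇒≡0 (subst (ℕD._∣ ℤ.∣ C i j ∣) colGcd≡0 (gcdList∣ entries (∈ₗ.∈-map⁺ (λ i → ℤ.∣ C i j ∣) (∈ₗ.∈-allFin i)))))
    where
    entries = map (λ i → ℤ.∣ C i j ∣) (allFin m)

    q∣entry : ∀ i → q ℕD.∣ ℤ.∣ C i j ∣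
    q∣entry i = ℤD.∣⇒∣ᵤ (subst (_ ∣_) (⊙-basis i C j) (implied (basis i) (λ l l∈J → ⊥-elim (empty (l , l∈J)))))

    colGcd≡0 : colGcd C j ≡ 0
    colGcd≡0 with colGcd C j | ∣gcdList {q} entries (λ x∈ → let i , _ , x≡ = ∈ₗ.∈-map⁻ (λ i → ℤ.∣ C i j ∣) x∈
                                                             in subst (q ℕD.∣_) (sym x≡) (q∣entry i)) | colGcd≤q* j
    ... | zero  | _   | _   = refl
    ... | suc g | q∣g | g≤q* = ⊥-elim (ℕP.<⇒≱ (ℕP.≤-<-trans g≤q* q*<q) (ℕD.∣⇒≤ q∣g))

  solvable⇒beyond-rank : ∀ {q} → 0 ℕ.< q → q* ℕ.< q → ∀ J (ne : Nonempty J) → InLℤ q J →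
                         ∀ a → rkC J ℕ.≤ toℕ a → (bOn J ⊙ SNF.V (SC J ne)) a ≡ 0ℤ
  solvable⇒beyond-rank {q} 0<q q*<q J ne sol a r≤a with (bOn J ⊙ SNF.V (SC J ne)) a ℤ.≟ 0ℤ
  ... | yes β≡0 = β≡0
  ... | no  β≢0 = ⊥-elim (∤-below (SmithForm.e>0 (SA J ne) (subst (0 ℕ.<_) (sym rank) (s≤s z≤n))) (eA≤q* J ne rank) q*<q
                           (AppendedRow.solvable⇒∣lastFactor (SC J ne) (SA J ne) q 0<q (InLℤ⇒solvable q J sol) a r≤a β≢0))
    where rank = AppendedRow.rank≡suc (SC J ne) (SA J ne) a r≤a β≢0

  implied⇒beyond-rank : ∀ {q} → q* ℕ.< q → ∀ J (ne : Nonempty J) j → ImpliedAt q J j →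
                        ∀ i → rkC J ℕ.≤ toℕ i → SNF.U (SC J ne) i · column j ≡ 0ℤ
  implied⇒beyond-rank {q} q*<q J ne j implied i r≤i with SNF.U (SC J ne) i · column j ℤ.≟ 0ℤ
  ... | yes u≡0 = u≡0
  ... | no  u≢0 = ⊥-elim (∤-below (SmithForm.e>0 (SC J′ ne′) (subst (0 ℕ.<_) (sym rank) (s≤s z≤n))) (eC∪≤q* J ne j rank) q*<q
                           (implied⇒∣lastFactor q J j (SC J′ ne′) implied (SNF.U (SC J ne) i)
                             (null-subMat⇒ J (SNF.U (SC J ne) i) (SmithForm.U-beyond-rank (SC J ne) i r≤i)) u≢0))
    where J′ = J ∪ ⁅ j ⁆
          ne′ = j , x∈p∪q⁺ (inj₂ (x∈⁅x⁆ j))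
          rank = rank-∪ J j (SC J ne) (SC J′ ne′) i r≤i u≢0

  module _ {q q′ : ℕ} (0<q : 0 ℕ.< q) (q*<q : q* ℕ.< q) (q*<q′ : q* ℕ.< q′) (gcd≡ : gcd (ρ₀ eC) q ≡ gcd (ρ₀ eC) q′) where

    gcd-invariantFactor : ∀ J (ne : Nonempty J) t → t ℕ.< rkC J → gcd q (SNF.d (SC J ne) t) ≡ gcd q′ (SNF.d (SC J ne) t)
    gcd-invariantFactor J ne t t<r = trans (gcd-factor-through q dₜ (ρ₀ eC) dₜ∣ρ)
                                          (trans (cong (λ g → gcd g dₜ) gcd≡) (sym (gcd-factor-through q′ dₜ (ρ₀ eC) dₜ∣ρ)))
      where dₜ = SNF.d (SC J ne) t
            dₜ∣ρ = invariantFactor∣ρ₀ J ne t t<r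

    InLℤ-transfer : ∀ J → InLℤ q J → InLℤ q′ J
    InLℤ-transfer J sol with nonempty? J
    ... | no  empty = (λ _ → 0ℤ) , λ j j∈J → ⊥-elim (empty (j , j∈J))
    ... | yes ne    = solvable⇒InLℤ q′ J (gcd∣⇒solvable q′ (bOn J) (solvable⇒beyond-rank 0<q q*<q J ne sol) λ a a<r →
                        subst (λ g → + g ∣ _) (gcd-invariantFactor J ne (toℕ a) a<r) (solvable⇒gcd∣ q (bOn J) (InLℤ⇒solvable q J sol) a a<r))
      where open SmithForm (SC J ne)

    ImpliedAt-transfer : ∀ J j → ImpliedAt q J j → ImpliedAt q′ J j
    ImpliedAt-transfer J j implied with nonempty? J
    ... | no  empty = ⊥-elim (¬implied-by-∅ q*<q J j empty implied)
    ... | yes ne    = ImpliedMod⇒ImpliedAt q′ J j (gcd∣⇒implied q′ (column j) (implied⇒beyond-rank q*<q J ne j implied) λ i i<r →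
                        subst (λ g → + g ∣ _) (gcd-invariantFactor J ne (toℕ i) i<r)
                          (implied⇒gcd∣ q (column j) 0<q (ImpliedAt⇒ImpliedMod q J j implied) i i<r))
      where open SmithForm (SC J ne)

    LeLℤ-transfer : ∀ J₁ J₂ → InLℤ q J₂ → LeLℤ q J₁ J₂ → LeLℤ q′ J₁ J₂
    LeLℤ-transfer J₁ J₂ nonempty H₂⊆H₁ = implied⇒≤ q′ J₁ J₂ λ j j∈J₁ →
      InLℤ-transfer _ (≤⇒∪-nonempty q J₁ J₂ nonempty H₂⊆H₁ j j∈J₁) , ImpliedAt-transfer J₂ j (≤⇒implied q J₁ J₂ nonempty H₂⊆H₁ j j∈J₁)

  isomorphic : ∀ q q′ → 0 ℕ.< q → 0 ℕ.< q′ → q* ℕ.< q → q* ℕ.< q′ → gcd (ρ₀ eC) q ≡ gcd (ρ₀ eC) q′ → IsoL C b q q′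
  isomorphic q q′ 0<q 0<q′ q*<q q*<q′ gcd≡ =
      (λ J → lift⁺ J , lift⁻ J)
    , (λ J₁ J₂ _ H₂ _ H₂′ → (λ ≤ → LeLℤ⇒LeL q′ J₁ J₂ (LeLℤ-transfer 0<q q*<q q*<q′ gcd≡ J₁ J₂ (InL⇒InLℤ q J₂ H₂) (LeL⇒LeLℤ q 0<q J₁ J₂ ≤)))
                          , (λ ≤ → LeLℤ⇒LeL q J₁ J₂ (LeLℤ-transfer 0<q′ q*<q′ q*<q (sym gcd≡) J₁ J₂ (InL⇒InLℤ q′ J₂ H₂′) (LeL⇒LeLℤ q′ 0<q′ J₁ J₂ ≤))))
    where
    lift⁺ : ∀ J → InL q C b J → InL q′ C b J
    lift⁺ J H = InLℤ⇒InL q′ 0<q′ J (InLℤ-transfer 0<q q*<q q*<q′ gcd≡ J (InL⇒InLℤ q J H))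
    lift⁻ : ∀ J → InL q′ C b J → InL q C b J
    lift⁻ J H = InLℤ⇒InL q 0<q J (InLℤ-transfer 0<q′ q*<q′ q*<q (sym gcd≡) J (InL⇒InLℤ q′ J H))

corollary4p4 :
  (m n : ℕ) → 1 ℕ.≤ m → 1 ℕ.≤ n →
  (C : Mat m n) → (∀ j → ¬ (∀ i → C i j ≡ + 0)) →
  (b : Fin n → ℤ) →
  (rkC eC rkA eA : Subset n → ℕ) →
  (∀ J → Nonempty J → SNF (subMat C J) (rkC J) (eC J)) →
  (∀ J → Nonempty J → SNF (augMat C b J) (rkA J) (eA J)) →
  ((q q' : ℕ) → 0 ℕ.< q → 0 ℕ.< q' →
     qStar C rkC eC rkA eA ℕ.< q → qStar C rkC eC rkA eA ℕ.< q' →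
     gcd (ρ₀ eC) q ≡ gcd (ρ₀ eC) q' →
     IsoL C b q q')
  × ((q : ℕ) → qStar C rkC eC rkA eA ℕ.< q → IsoL C b q (q ℕ.+ ρ₀ eC))
corollary4p4 m n _ _ C nonzero-columns b rkC eC rkA eA SC SA = isomorphic , periodic
  where
  open Transfer C nonzero-columns b rkC eC rkA eA SC SA
  periodic : ∀ q → q* ℕ.< q → IsoL C b q (q ℕ.+ ρ₀ eC)
  periodic q q*<q = isomorphic q (q ℕ.+ ρ₀ eC) 0<q (ℕP.<-≤-trans 0<q (ℕP.m≤m+n q _))
                               q*<q (ℕP.<-≤-trans q*<q (ℕP.m≤m+n q _)) (gcd[ρ,q]≡gcd[ρ,q+ρ] q (ρ₀ eC))
    where 0<q = ℕP.≤-<-trans z≤n q*<q
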